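{- Let $p$ be a prime with $p\equiv 2\pmod 3$, $m_p=(p+1)/3$, and $I_p=\{m_p,m_p+1,\ldots,2m_p-1\}\subset\mathbb{F}_p$. Let $n\ge 3$, let $A\subset\mathbb{F}_p^n$ be sum-free, and let $u\in\mathbb{F}_p^n\setminus\{0\}$ be such that $I_p(u):=\{xu:x\in I_p\}\subset A$. Then there exist two distinct subspaces $W_1,W_2<\mathbb{F}_p^n$ of co-dimension $1$ such that $I_p(u)\subset W_1\cap W_2$ and $|W_i\cap A|\ge |A|/p$ for $i\in\{1,2\}$.
   Context: A set $A\subset\mathbb{F}_p^n$ is sum-free if there are no $a,b,c\in A$ with $a+b=c$. -}

module Defs where

open import Data.Nat using (ℕ; zero; suc; _+_; _*_; NonZero; _≡ᵇ_)
open import Data.Nat.DivMod using (_mod_)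
open import Data.Fin using (Fin; toℕ)
open import Data.Vec using (Vec; []; _∷_; replicate; zipWith; map; foldr)
open import Data.List as L using (List; allFin; concatMap; filterᵇ; length)
open import Data.Bool using (Bool; true; _∧_)
open import Relation.Binary.PropositionalEquality using (_≡_)

module _ (p : ℕ) .{{_ : NonZero p}} where

  F : Set
  F = Fin p

  0F : F
  0F = 0 mod p

  _+F_ : F → F → F
  a +F b = (toℕ a + toℕ b) mod p

  _*F_ : F → F → F
  a *F b = (toℕ a * toℕ b) mod p

  _+V_ : ∀ {n} → Vec F n → Vec F n → Vec F n
  _+V_ = zipWith _+F_

  0V : ∀ n → Vec F n
  0V n = replicate n 0F

  -- scalar multiple by the element (k mod p) of F_p
  _·V_ : ∀ {n} → ℕ → Vec F n → Vec F n
  k ·V u = map (λ a → (k * toℕ a) mod p) u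

  dot : ∀ {n} → Vec F n → Vec F n → F
  dot a x = foldr _ _+F_ 0F (zipWith _*F_ a x)

  allVecs : ∀ n → List (Vec F n)
  allVecs zero = [] L.∷ L.[]
  allVecs (suc n) = concatMap (λ a → L.map (a ∷_) (allVecs n)) (allFin p)

  Subset : ℕ → Set
  Subset n = Vec F n → Bool

  _∈_ : ∀ {n} → Vec F n → Subset n → Set
  x ∈ A = A x ≡ true

  card : ∀ {n} → Subset n → ℕ
  card {n} A = length (filterᵇ A (allVecs n))

  SumFree : ∀ {n} → Subset n → Set
  SumFree A = ∀ a b c → a ∈ A → b ∈ A → c ∈ A → (a +V b) ≡ c → Data.Empty.⊥
    where import Data.Empty

  -- The codimension-1 subspace (hyperplane) W_a = { x : a · x = 0 },
  -- for a nonzero functional a (every codim-1 subspace is of this form).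
  Hyp : ∀ {n} → Vec F n → Subset n
  Hyp a x = toℕ (dot a x) ≡ᵇ 0

  _∩_ : ∀ {n} → Subset n → Subset n → Subset n
  (A ∩ B) x = A x ∧ B x

{-# OPTIONS --safe #-}
module Submission where

open import Data.Bool using (Bool; true; false; not; _∧_)
open import Data.Bool.Properties using (¬-not) renaming (_≟_ to _≟ᵇ_)
open import Data.Fin as Fin using (Fin; zero; suc; toℕ)
open import Data.Fin.Properties using (toℕ-injective; toℕ<n; toℕ-fromℕ<; any?; ¬∀⟶∃¬)
open import Data.List using (List; []; _∷_; _++_; map; concatMap; length; filterᵇ; tabulate; allFin)
open import Data.List.Properties using (map-tabulate; length-tabulate)
open import Data.List.Relation.Unary.All as All using (All; []; _∷_)
open import Data.List.Relation.Unary.All.Properties using (¬Any⇒All¬)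
open import Data.List.Relation.Unary.Any as Any using (satisfied)
open import Data.Nat
open import Data.Nat.Coprimality using (Coprime; coprime-Bézout)
open import Data.Nat.DivMod
open import Data.Nat.Divisibility using (_∣_; m%n≡0⇒n∣m; n∣m⇒m%n≡0)
open import Data.Nat.GCD using (module Bézout)
open import Data.Nat.Primality using (Prime; euclidsLemma; prime⇒irreducible; prime⇒nonTrivial)
open import Data.Nat.Properties
open import Data.Nat.Solver using (module +-*-Solver)
open import Data.Product using (Σ; ∃; _×_; _,_; proj₁; proj₂; uncurry)
open import Data.Product.Properties using () renaming (≡-dec to ×-≡-dec)
open import Data.Sum using (_⊎_; inj₁; inj₂)
open import Data.Vec using (Vec; []; _∷_; head; tail; lookup; insertAt; removeAt)
open import Data.Vec.Properties
  using (≡-dec; ∷-injectiveˡ; ∷-injectiveʳ; lookup-zipWith; lookup-map; lookup-replicate;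
         insertAt-lookup; insertAt-removeAt; removeAt-insertAt)
open import Function using (_∘_; id; _⇔_; mk⇔; Equivalence; Inverse; _↔_; mk↔ₛ′)
open import Function.Construct.Composition using (_⇔-∘_)
open import Function.Construct.Identity using (↔-id)
open import Function.Construct.Symmetry using (⇔-sym)
open import Relation.Binary.Definitions using (DecidableEquality)
open import Relation.Binary.PropositionalEquality
open import Relation.Nullary using (¬_; does; yes; no; contradiction; ¬?; _×-dec_)
open import Algebra.Properties.CommutativeSemigroup +-commutativeSemigroup
  using () renaming (interchange to +-interchange)
open import Defs
open +-*-Solver using (solve; _:+_; _:*_; _:=_; con)

-- Fibre F_p^n into the lines x + F_p u over a complement of u and let g y count the points
-- of A on the line over y; the hyperplanes W ⊇ u are the pull-backs of the hyperplanes of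
-- the complement, and |A ∩ W| is the g-mass of the hyperplane below W.  A point x ∈ A
-- excludes x + I_p(u) from A, and as p = 3 m_p - 1 this leaves at most m_p points of A on
-- each line, while the line through 0 contains I_p(u).  The p + 1 hyperplanes through a
-- subspace K of codimension 2 cover each point outside K once and K p + 1 times, so their
-- masses add up to |g| + p g(K).  Averaging over such a pencil lifts a hyperplane H of the
-- slice y₀ = 0 with p g(H) ≥ |g on the slice| to a hyperplane W of the whole space with
-- p g(W) ≥ |g|.  In the plane the bounds g ≤ m_p ≤ g(0) force a second line through 0 with
-- this property, and induction on the dimension carries both hyperplanes along.

-- Counting

⟦_⟧ : Bool → ℕ
⟦ true ⟧  = 1
⟦ false ⟧ = 0

⟦∧⟧ : ∀ a b → ⟦ a ∧ b ⟧ ≡ ⟦ a ⟧ * ⟦ b ⟧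
⟦∧⟧ true  b = sym (+-identityʳ ⟦ b ⟧)
⟦∧⟧ false b = refl

⟦⟧≤1 : ∀ b → ⟦ b ⟧ ≤ 1
⟦⟧≤1 true  = ≤-refl
⟦⟧≤1 false = z≤n

≡ᵇ0⇔≡0 : ∀ m → (m ≡ᵇ 0) ≡ true ⇔ m ≡ 0
≡ᵇ0⇔≡0 zero    = mk⇔ (λ _ → refl) (λ _ → refl)
≡ᵇ0⇔≡0 (suc m) = mk⇔ (λ ()) (λ ())

≡true⇔⇒≡ : ∀ {b c : Bool} → b ≡ true ⇔ c ≡ true → b ≡ c
≡true⇔⇒≡ {true}  {true}  _   = refl
≡true⇔⇒≡ {false} {false} _   = refl
≡true⇔⇒≡ {true}  {false} b⇔c = sym (Equivalence.to b⇔c refl)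
≡true⇔⇒≡ {false} {true}  b⇔c = Equivalence.from b⇔c refl

∑ : {X : Set} → List X → (X → ℕ) → ℕ
∑ []       f = 0
∑ (x ∷ xs) f = f x + ∑ xs f

syntax ∑ L (λ x → e) = ∑[ x ∈ L ] e

module _ {X : Set} where

  ∑-cong : ∀ L {f g : X → ℕ} → (∀ x → f x ≡ g x) → ∑ L f ≡ ∑ L g
  ∑-cong []      f≡g = refl
  ∑-cong (x ∷ L) f≡g = cong₂ _+_ (f≡g x) (∑-cong L f≡g)

  ∑-mono-≤ : ∀ L {f g : X → ℕ} → (∀ x → f x ≤ g x) → ∑ L f ≤ ∑ L g
  ∑-mono-≤ []      f≤g = z≤n
  ∑-mono-≤ (x ∷ L) f≤g = +-mono-≤ (f≤g x) (∑-mono-≤ L f≤g)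

  ∑-mono-≤-All : ∀ {L} {f g : X → ℕ} → All (λ x → f x ≤ g x) L → ∑ L f ≤ ∑ L g
  ∑-mono-≤-All []            = z≤n
  ∑-mono-≤-All (fx≤gx ∷ f≤g) = +-mono-≤ fx≤gx (∑-mono-≤-All f≤g)

  ∑-distrib-+ : ∀ L (f g : X → ℕ) → ∑[ x ∈ L ] (f x + g x) ≡ ∑ L f + ∑ L g
  ∑-distrib-+ []      f g = refl
  ∑-distrib-+ (x ∷ L) f g = begin
    (f x + g x) + ∑[ y ∈ L ] (f y + g y) ≡⟨ cong (f x + g x +_) (∑-distrib-+ L f g) ⟩
    (f x + g x) + (∑ L f + ∑ L g)        ≡⟨ +-interchange (f x) (g x) (∑ L f) (∑ L g) ⟩
    (f x + ∑ L f) + (g x + ∑ L g)        ∎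
    where open ≡-Reasoning

  ∑-*ˡ : ∀ L k (f : X → ℕ) → ∑[ x ∈ L ] (k * f x) ≡ k * ∑ L f
  ∑-*ˡ []      k f = sym (*-zeroʳ k)
  ∑-*ˡ (x ∷ L) k f = trans (cong (k * f x +_) (∑-*ˡ L k f)) (sym (*-distribˡ-+ k (f x) (∑ L f)))

  ∑-*ʳ : ∀ L k (f : X → ℕ) → ∑[ x ∈ L ] (f x * k) ≡ ∑ L f * k
  ∑-*ʳ L k f = trans (∑-cong L (λ x → *-comm (f x) k)) (trans (∑-*ˡ L k f) (*-comm k (∑ L f)))

  ∑-const : ∀ L k → ∑[ x ∈ L ] k ≡ length {A = X} L * k
  ∑-const []      k = refl
  ∑-const (x ∷ L) k = cong (k +_) (∑-const L k)

  ∑-++ : ∀ L M (f : X → ℕ) → ∑ (L ++ M) f ≡ ∑ L f + ∑ M f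
  ∑-++ []      M f = refl
  ∑-++ (x ∷ L) M f = trans (cong (f x +_) (∑-++ L M f)) (sym (+-assoc (f x) (∑ L f) (∑ M f)))

  ∑-filter : ∀ (A : X → Bool) L → length (filterᵇ A L) ≡ ∑[ x ∈ L ] ⟦ A x ⟧
  ∑-filter A []      = refl
  ∑-filter A (x ∷ L) with A x
  ... | true  = cong suc (∑-filter A L)
  ... | false = ∑-filter A L

  ∃-≥-mean : ∀ L (f : X → ℕ) s → 0 < length L → s ≤ ∑ L f → ∃ λ x → s ≤ length L * f x
  ∃-≥-mean L f s 0<n s≤∑f with Any.any? (λ x → s ≤? length L * f x) L
  ... | yes found = satisfied found
  ... | no none   = contradiction n≤0 (<⇒≱ 0<n)
    where
    open ≤-Reasoning
    n = length L
    n≤0 : n ≤ 0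
    n≤0 = +-cancelʳ-≤ (n * ∑ L f) n 0 (begin
      n + n * ∑ L f
        ≡⟨ cong₂ _+_ (trans (sym (*-identityʳ n)) (sym (∑-const L 1))) (sym (∑-*ˡ L n f)) ⟩
      ∑[ x ∈ L ] 1 + ∑[ x ∈ L ] (n * f x)
        ≡⟨ ∑-distrib-+ L (λ _ → 1) (λ x → n * f x) ⟨
      ∑[ x ∈ L ] suc (n * f x)
        ≤⟨ ∑-mono-≤-All (All.map ≰⇒> (¬Any⇒All¬ L none)) ⟩
      ∑[ x ∈ L ] s
        ≡⟨ ∑-const L s ⟩
      n * s
        ≤⟨ *-monoʳ-≤ n s≤∑f ⟩
      0 + n * ∑ L f ∎)

module _ {Y X : Set} where

  ∑-map : ∀ (φ : Y → X) L (f : X → ℕ) → ∑ (map φ L) f ≡ ∑ L (f ∘ φ)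
  ∑-map φ []      f = refl
  ∑-map φ (y ∷ L) f = cong (f (φ y) +_) (∑-map φ L f)

  ∑-concatMap : ∀ (φ : Y → List X) L (f : X → ℕ) → ∑ (concatMap φ L) f ≡ ∑[ y ∈ L ] ∑ (φ y) f
  ∑-concatMap φ []      f = refl
  ∑-concatMap φ (y ∷ L) f = trans (∑-++ (φ y) _ f) (cong (∑ (φ y) f +_) (∑-concatMap φ L f))

  ∑-comm : ∀ (L : List X) (M : List Y) (h : X → Y → ℕ) →
           ∑[ x ∈ L ] ∑[ y ∈ M ] h x y ≡ ∑[ y ∈ M ] ∑[ x ∈ L ] h x y
  ∑-comm []      M h = sym (trans (∑-const M 0) (*-zeroʳ (length M)))
  ∑-comm (x ∷ L) M h = trans (cong (∑ M (h x) +_) (∑-comm L M h)) (sym (∑-distrib-+ M (h x) _))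

module _ {X : Set} (_≟_ : DecidableEquality X) where

  δ : X → X → ℕ
  δ x y = ⟦ does (x ≟ y) ⟧

  δᶜ : X → X → ℕ
  δᶜ x y = ⟦ not (does (x ≟ y)) ⟧

  δ-≡ : ∀ {x y} → x ≡ y → δ x y ≡ 1
  δ-≡ {x} {y} x≡y with x ≟ y
  ... | yes _   = refl
  ... | no x≢y = contradiction x≡y x≢y

  δ-≢ : ∀ {x y} → ¬ x ≡ y → δ x y ≡ 0
  δ-≢ {x} {y} x≢y with x ≟ y
  ... | yes x≡y = contradiction x≡y x≢y
  ... | no _    = refl

  δ+δᶜ≡1 : ∀ x y → δ x y + δᶜ x y ≡ 1
  δ+δᶜ≡1 x y with x ≟ y
  ... | yes _ = refl
  ... | no _  = refl

  δ-*-transport : ∀ x y (h : X → ℕ) → δ x y * h x ≡ δ x y * h y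
  δ-*-transport x y h with x ≟ y
  ... | yes refl = refl
  ... | no _     = refl

  ⟦⟧≡δ : ∀ {b x y} → b ≡ true ⇔ x ≡ y → ⟦ b ⟧ ≡ δ x y
  ⟦⟧≡δ {b} {x} {y} b⇔x≡y with x ≟ y
  ... | yes x≡y = cong ⟦_⟧ (Equivalence.from b⇔x≡y x≡y)
  ... | no x≢y  with b
  ...   | true  = contradiction (Equivalence.to b⇔x≡y refl) x≢y
  ...   | false = refl

  record Enumerates (L : List X) : Set where
    constructor counting-once
    field once : ∀ y → ∑[ x ∈ L ] δ x y ≡ 1
  open Enumerates public

  module _ {L} (enum : Enumerates L) where

    ∑-δ : ∀ y (h : X → ℕ) → ∑[ x ∈ L ] (δ x y * h x) ≡ h y
    ∑-δ y h = begin
      ∑[ x ∈ L ] (δ x y * h x) ≡⟨ ∑-cong L (λ x → δ-*-transport x y h) ⟩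
      ∑[ x ∈ L ] (δ x y * h y) ≡⟨ ∑-*ʳ L (h y) (λ x → δ x y) ⟩
      ∑[ x ∈ L ] δ x y * h y   ≡⟨ cong (_* h y) (once enum y) ⟩
      1 * h y                  ≡⟨ *-identityˡ (h y) ⟩
      h y                      ∎
      where open ≡-Reasoning

    ∑-⟦⟧≡1 : ∀ (B : X → Bool) y → (∀ x → B x ≡ true ⇔ x ≡ y) → ∑[ x ∈ L ] ⟦ B x ⟧ ≡ 1
    ∑-⟦⟧≡1 B y B⇔≡y = trans (∑-cong L (λ x → ⟦⟧≡δ (B⇔≡y x))) (once enum y)

    ∑-split : ∀ y (f : X → ℕ) → ∑ L f ≡ f y + ∑[ x ∈ L ] (δᶜ x y * f x)
    ∑-split y f = begin
      ∑ L f
        ≡⟨ ∑-cong L (λ x → trans (cong (_* f x) (δ+δᶜ≡1 x y)) (*-identityˡ (f x))) ⟨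
      ∑[ x ∈ L ] ((δ x y + δᶜ x y) * f x)
        ≡⟨ ∑-cong L (λ x → *-distribʳ-+ (f x) (δ x y) (δᶜ x y)) ⟩
      ∑[ x ∈ L ] (δ x y * f x + δᶜ x y * f x)
        ≡⟨ ∑-distrib-+ L _ _ ⟩
      ∑[ x ∈ L ] (δ x y * f x) + ∑[ x ∈ L ] (δᶜ x y * f x)
        ≡⟨ cong (_+ ∑[ x ∈ L ] (δᶜ x y * f x)) (∑-δ y f) ⟩
      f y + ∑[ x ∈ L ] (δᶜ x y * f x) ∎
      where open ≡-Reasoning

    ∑-≤-off-one : ∀ y (f : X → ℕ) s → (∀ x → ¬ x ≡ y → length L * f x ≤ s) →
                  length L * ∑ L f + s ≤ length L * f y + length L * s
    ∑-≤-off-one y f s small = begin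
      n * ∑ L f + s                                 ≡⟨ cong (λ z → n * z + s) (∑-split y f) ⟩
      n * (f y + ∑[ x ∈ L ] (δᶜ x y * f x)) + s     ≡⟨ cong (_+ s) (*-distribˡ-+ n (f y) _) ⟩
      n * f y + n * ∑[ x ∈ L ] (δᶜ x y * f x) + s   ≡⟨ cong (λ z → n * f y + z + s) (∑-*ˡ L n _) ⟨
      n * f y + ∑[ x ∈ L ] (n * (δᶜ x y * f x)) + s ≤⟨ +-monoˡ-≤ s (+-monoʳ-≤ (n * f y) (∑-mono-≤ L off-y)) ⟩
      n * f y + ∑[ x ∈ L ] (δᶜ x y * s) + s         ≡⟨ cong (λ z → n * f y + z + s) (∑-*ʳ L s (λ x → δᶜ x y)) ⟩
      n * f y + E * s + s                           ≡⟨ +-assoc (n * f y) (E * s) s ⟩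
      n * f y + (E * s + s)                         ≡⟨ cong (n * f y +_) (+-comm (E * s) s) ⟩
      n * f y + (1 + E) * s                         ≡⟨ cong (λ z → n * f y + z * s) 1+E≡n ⟩
      n * f y + n * s                               ∎
      where
      open ≤-Reasoning
      n = length L
      E = ∑[ x ∈ L ] δᶜ x y
      1+E≡n : 1 + E ≡ n
      1+E≡n = begin-equality
        1 + E                       ≡⟨ cong (1 +_) (∑-cong L (λ x → *-identityʳ (δᶜ x y))) ⟨
        1 + ∑[ x ∈ L ] (δᶜ x y * 1) ≡⟨ ∑-split y (λ _ → 1) ⟨
        ∑[ x ∈ L ] 1                ≡⟨ ∑-const L 1 ⟩
        n * 1                       ≡⟨ *-identityʳ n ⟩
        n                           ∎
      off-y : ∀ x → n * (δᶜ x y * f x) ≤ δᶜ x y * s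
      off-y x with x ≟ y
      ... | yes _  = ≤-reflexive (*-zeroʳ n)
      ... | no x≢y = subst₂ _≤_ (cong (n *_) (sym (+-identityʳ (f x)))) (sym (+-identityʳ s)) (small x x≢y)

module _ {X Y : Set} (_≟X_ : DecidableEquality X) (_≟Y_ : DecidableEquality Y) (e : Y ↔ X) where
  open Inverse e

  δ-to : ∀ x y → δ _≟X_ x (to y) ≡ δ _≟Y_ y (from x)
  δ-to x y with x ≟X to y
  ... | yes x≡to[y] = sym (δ-≡ _≟Y_ (sym (inverseʳ x≡to[y])))
  ... | no x≢to[y]  = sym (δ-≢ _≟Y_ (λ y≡from[x] → x≢to[y] (sym (inverseˡ y≡from[x]))))

  ∑-reindex : ∀ {L M} → Enumerates _≟X_ L → Enumerates _≟Y_ M →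
              ∀ (h : X → ℕ) → ∑[ y ∈ M ] h (to y) ≡ ∑ L h
  ∑-reindex {L} {M} enumL enumM h = begin
    ∑[ y ∈ M ] h (to y)                             ≡⟨ ∑-cong M (λ y → ∑-δ _≟X_ enumL (to y) h) ⟨
    ∑[ y ∈ M ] ∑[ x ∈ L ] (δ _≟X_ x (to y) * h x)   ≡⟨ ∑-comm M L _ ⟩
    ∑[ x ∈ L ] ∑[ y ∈ M ] (δ _≟X_ x (to y) * h x)   ≡⟨ ∑-cong L (λ x → ∑-*ʳ M (h x) _) ⟩
    ∑[ x ∈ L ] (∑[ y ∈ M ] δ _≟X_ x (to y) * h x)   ≡⟨ ∑-cong L (λ x → cong (_* h x) (∑-cong M (δ-to x))) ⟩
    ∑[ x ∈ L ] (∑[ y ∈ M ] δ _≟Y_ y (from x) * h x) ≡⟨ ∑-cong L (λ x → cong (_* h x) (once enumM (from x))) ⟩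
    ∑[ x ∈ L ] (1 * h x)                            ≡⟨ ∑-cong L (λ x → *-identityˡ (h x)) ⟩
    ∑ L h                                           ∎
    where open ≡-Reasoning

module _ {X Y Z : Set} (_≟X_ : DecidableEquality X) (_≟Y_ : DecidableEquality Y)
         (_≟Z_ : DecidableEquality Z) (e : (X × Y) ↔ Z) where
  open Inverse e

  δ-to-pair : ∀ x y z → δ _≟Z_ (to (x , y)) z ≡ δ _≟X_ x (proj₁ (from z)) * δ _≟Y_ y (proj₂ (from z))
  δ-to-pair x y z with to (x , y) ≟Z z
  ... | yes to[x,y]≡z = sym (cong₂ _*_ (δ-≡ _≟X_ (cong proj₁ from[z]≡x,y)) (δ-≡ _≟Y_ (cong proj₂ from[z]≡x,y)))
    where from[z]≡x,y = sym (inverseʳ (sym to[x,y]≡z))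
  ... | no to[x,y]≢z with x ≟X proj₁ (from z) | y ≟Y proj₂ (from z)
  ...   | yes refl | yes refl = contradiction (inverseˡ refl) to[x,y]≢z
  ...   | yes _    | no _     = refl
  ...   | no _     | _        = refl

  enumerates-concatMap : ∀ {L M} → Enumerates _≟X_ L → Enumerates _≟Y_ M →
                         Enumerates _≟Z_ (concatMap (λ x → map (λ y → to (x , y)) M) L)
  enumerates-concatMap {L} {M} enumL enumM = counting-once λ z →
    let a = proj₁ (from z); b = proj₂ (from z) in begin
    ∑ (concatMap (λ x → map (λ y → to (x , y)) M) L) (λ w → δ _≟Z_ w z)
      ≡⟨ trans (∑-concatMap _ L _) (∑-cong L (λ x → ∑-map _ M _)) ⟩
    ∑[ x ∈ L ] ∑[ y ∈ M ] δ _≟Z_ (to (x , y)) z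
      ≡⟨ ∑-cong L (λ x → ∑-cong M (λ y → δ-to-pair x y z)) ⟩
    ∑[ x ∈ L ] ∑[ y ∈ M ] (δ _≟X_ x a * δ _≟Y_ y b)
      ≡⟨ ∑-cong L (λ x → ∑-*ˡ M (δ _≟X_ x a) _) ⟩
    ∑[ x ∈ L ] (δ _≟X_ x a * ∑[ y ∈ M ] δ _≟Y_ y b)
      ≡⟨ ∑-cong L (λ x → trans (cong (δ _≟X_ x a *_) (once enumM b)) (*-identityʳ _)) ⟩
    ∑[ x ∈ L ] δ _≟X_ x a
      ≡⟨ once enumL a ⟩
    1 ∎
    where open ≡-Reasoning

∑-tabulate : ∀ {X : Set} {n} (f : Fin n → X) (h : X → ℕ) → ∑ (tabulate f) h ≡ ∑[ i ∈ allFin n ] h (f i)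
∑-tabulate f h = trans (cong (λ L → ∑ L h) (sym (map-tabulate id f))) (∑-map f (allFin _) h)

length-allFin : ∀ n → length (allFin n) ≡ n
length-allFin n = length-tabulate id

∑-allFin-const : ∀ n k → ∑[ i ∈ allFin n ] k ≡ n * k
∑-allFin-const n k = trans (∑-const (allFin n) k) (cong (_* k) (length-allFin n))

enumerates-allFin : ∀ n → Enumerates Fin._≟_ (allFin n)
enumerates-allFin n = counting-once (counted-once n)
  where
  counted-once : ∀ n (j : Fin n) → ∑[ i ∈ allFin n ] δ Fin._≟_ i j ≡ 1
  counted-once (suc n) zero    = cong suc (trans (∑-tabulate suc (λ i → δ (Fin._≟_ {suc n}) i zero))
                                                 (trans (∑-allFin-const n 0) (*-zeroʳ n)))
  counted-once (suc n) (suc j) = trans (∑-tabulate suc (λ i → δ Fin._≟_ i (suc j))) (counted-once n j)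

cons-↔ : ∀ {X : Set} {d} → (X × Vec X d) ↔ Vec X (suc d)
cons-↔ = mk↔ₛ′ (uncurry _∷_) (λ v → head v , tail v) head∷tail (λ _ → refl)
  where
  head∷tail : ∀ {X : Set} {d} (v : Vec X (suc d)) → head v ∷ tail v ≡ v
  head∷tail (a ∷ v) = refl

module _ (p : ℕ) .{{_ : NonZero p}} where

  enumerates-allVecs : ∀ d → Enumerates (≡-dec Fin._≟_) (allVecs p d)
  enumerates-allVecs zero    = counting-once (λ { [] → refl })
  enumerates-allVecs (suc d) = enumerates-concatMap Fin._≟_ (≡-dec Fin._≟_) (≡-dec Fin._≟_) cons-↔
                                                    (enumerates-allFin p) (enumerates-allVecs d)

  ∑-allVecs-suc : ∀ {d} (h : Vec (F p) (suc d) → ℕ) →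
                  ∑ (allVecs p (suc d)) h ≡ ∑[ a ∈ allFin p ] ∑[ z ∈ allVecs p d ] h (a ∷ z)
  ∑-allVecs-suc {d} h = trans (∑-concatMap _ (allFin p) h) (∑-cong (allFin p) (λ a → ∑-map (a ∷_) (allVecs p d) h))

∑< : ℕ → (ℕ → ℕ) → ℕ
∑< zero    H = 0
∑< (suc n) H = H 0 + ∑< n (λ j → H (suc j))

syntax ∑< n (λ j → e) = ∑[ j < n ] e

∑<-cong : ∀ n {H G : ℕ → ℕ} → (∀ j → j < n → H j ≡ G j) → ∑< n H ≡ ∑< n G
∑<-cong zero    H≡G = refl
∑<-cong (suc n) H≡G = cong₂ _+_ (H≡G 0 z<s) (∑<-cong n (λ j j<n → H≡G (suc j) (s<s j<n)))

∑<-mono-≤ : ∀ n {H G : ℕ → ℕ} → (∀ j → H j ≤ G j) → ∑< n H ≤ ∑< n G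
∑<-mono-≤ zero    H≤G = z≤n
∑<-mono-≤ (suc n) H≤G = +-mono-≤ (H≤G 0) (∑<-mono-≤ n (λ j → H≤G (suc j)))

∑<-const : ∀ n k → ∑[ j < n ] k ≡ n * k
∑<-const zero    k = refl
∑<-const (suc n) k = cong (k +_) (∑<-const n k)

∑<-distrib-+ : ∀ n (H G : ℕ → ℕ) → ∑[ j < n ] (H j + G j) ≡ ∑< n H + ∑< n G
∑<-distrib-+ zero    H G = refl
∑<-distrib-+ (suc n) H G = trans (cong (H 0 + G 0 +_) (∑<-distrib-+ n _ _))
                                 (+-interchange (H 0) (G 0) (∑< n (λ j → H (suc j))) (∑< n (λ j → G (suc j))))

∑<-+ : ∀ a b (H : ℕ → ℕ) → ∑< (a + b) H ≡ ∑< a H + ∑[ j < b ] H (a + j)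
∑<-+ zero    b H = refl
∑<-+ (suc a) b H = trans (cong (H 0 +_) (∑<-+ a b (λ j → H (suc j)))) (sym (+-assoc (H 0) _ _))

∑-allFin-toℕ : ∀ n (H : ℕ → ℕ) → ∑[ i ∈ allFin n ] H (toℕ i) ≡ ∑< n H
∑-allFin-toℕ zero    H = refl
∑-allFin-toℕ (suc n) H =
  cong (H 0 +_) (trans (∑-tabulate {n = n} suc (λ i → H (toℕ i))) (∑-allFin-toℕ n (λ j → H (suc j))))

-- Arithmetic of F_p on ℕ representatives

module Modular (p : ℕ) .{{_ : NonZero p}} where

  open ≡-Reasoning

  infix 4 _≈_
  _≈_ : ℕ → ℕ → Set
  a ≈ b = a % p ≡ b % p

  %-≈ : ∀ a → a % p ≈ a
  %-≈ a = m%n%n≡m%n a p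

  +-cong : ∀ {a b c d} → a ≈ b → c ≈ d → a + c ≈ b + d
  +-cong {a} {b} {c} {d} a≈b c≈d = begin
    (a + c) % p             ≡⟨ %-distribˡ-+ a c p ⟩
    (a % p + c % p) % p     ≡⟨ cong₂ (λ x y → (x + y) % p) a≈b c≈d ⟩
    (b % p + d % p) % p     ≡⟨ %-distribˡ-+ b d p ⟨
    (b + d) % p             ∎

  *-cong : ∀ {a b c d} → a ≈ b → c ≈ d → a * c ≈ b * d
  *-cong {a} {b} {c} {d} a≈b c≈d = begin
    (a * c) % p             ≡⟨ %-distribˡ-* a c p ⟩
    (a % p * (c % p)) % p   ≡⟨ cong₂ (λ x y → (x * y) % p) a≈b c≈d ⟩
    (b % p * (d % p)) % p   ≡⟨ %-distribˡ-* b d p ⟨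
    (b * d) % p             ∎

  +-congˡ : ∀ a {c d} → c ≈ d → a + c ≈ a + d
  +-congˡ a = +-cong {a} refl

  *-congˡ : ∀ a {c d} → c ≈ d → a * c ≈ a * d
  *-congˡ a = *-cong {a} refl

  *-congʳ : ∀ {a b} c → a ≈ b → a * c ≈ b * c
  *-congʳ c a≈b = *-cong a≈b (refl {x = c % p})

  +-*p-≈ : ∀ a k → a + k * p ≈ a
  +-*p-≈ a k = [m+kn]%n≡m%n a k p

  0%p : 0 % p ≡ 0
  0%p = m<n⇒m%n≡m (>-nonZero⁻¹ p)

  neg : ℕ → ℕ
  neg a = (p ∸ 1) * a

  neg-inverseˡ : ∀ a → neg a + a ≈ 0
  neg-inverseˡ a = trans (cong (_% p) ([q∸1]a+a≡aq p)) (+-*p-≈ 0 a)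
    where
    [q∸1]a+a≡aq : ∀ q .{{_ : NonZero q}} → (q ∸ 1) * a + a ≡ 0 + a * q
    [q∸1]a+a≡aq (suc k) = solve 2 (λ k a → k :* a :+ a := con 0 :+ a :* (con 1 :+ k)) refl k a

  neg-inverseʳ : ∀ a → a + neg a ≈ 0
  neg-inverseʳ a = trans (cong (_% p) (+-comm a (neg a))) (neg-inverseˡ a)

  +-cancelʳ-≈ : ∀ {a b} c → a + c ≈ b + c → a ≈ b
  +-cancelʳ-≈ {a} {b} c a+c≈b+c = begin
    a % p                 ≡⟨ cancel a ⟨
    (a + c + neg c) % p   ≡⟨ +-cong a+c≈b+c (refl {x = neg c % p}) ⟩
    (b + c + neg c) % p   ≡⟨ cancel b ⟩
    b % p                 ∎
    where
    cancel : ∀ x → x + c + neg c ≈ x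
    cancel x = trans (cong (_% p) (+-assoc x c (neg c)))
                     (trans (+-congˡ x (neg-inverseʳ c)) (cong (_% p) (+-identityʳ x)))

  ≈0-cong : ∀ {a b} → a ≈ b → a ≈ 0 ⇔ b ≈ 0
  ≈0-cong a≈b = mk⇔ (trans (sym a≈b)) (trans a≈b)

  toℕ-mod : ∀ a → toℕ (a mod p) ≈ a
  toℕ-mod a = trans (cong (_% p) (toℕ-fromℕ< (m%n<n a p))) (%-≈ a)

  toℕ-% : (x : F p) → toℕ x % p ≡ toℕ x
  toℕ-% x = m<n⇒m%n≡m (toℕ<n x)

  toℕ-≈-injective : ∀ {x y : F p} → toℕ x ≈ toℕ y → x ≡ y
  toℕ-≈-injective {x} {y} x≈y = toℕ-injective (trans (sym (toℕ-% x)) (trans x≈y (toℕ-% y)))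

  toℕ-0F : toℕ (0F p) ≡ 0
  toℕ-0F = trans (toℕ-fromℕ< (m%n<n 0 p)) 0%p

  toℕ-≈0 : (x : F p) → toℕ x ≈ 0 → toℕ x ≡ 0
  toℕ-≈0 x x≈0 = trans (sym (toℕ-% x)) (trans x≈0 0%p)

  toℕ≈0⇔≡0F : ∀ (x : F p) → toℕ x ≈ 0 ⇔ x ≡ 0F p
  toℕ≈0⇔≡0F x = mk⇔ (λ x≈0 → toℕ-≈-injective (trans x≈0 (cong (_% p) (sym toℕ-0F))))
                     (λ { refl → cong (_% p) toℕ-0F })

  ≢0F⇒≉0 : ∀ {x : F p} → ¬ x ≡ 0F p → ¬ toℕ x ≈ 0
  ≢0F⇒≉0 {x} x≢0 x≈0 = x≢0 (Equivalence.to (toℕ≈0⇔≡0F x) x≈0)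

  toℕ-+F : (x y : F p) → toℕ (_+F_ p x y) ≈ toℕ x + toℕ y
  toℕ-+F x y = toℕ-mod (toℕ x + toℕ y)

  toℕ-*F : (x y : F p) → toℕ (_*F_ p x y) ≈ toℕ x * toℕ y
  toℕ-*F x y = toℕ-mod (toℕ x * toℕ y)

  ≈0⇔∣ : ∀ a → a ≈ 0 ⇔ p ∣ a
  ≈0⇔∣ a = mk⇔ (λ a≈0 → m%n≡0⇒n∣m a p (trans a≈0 0%p))
               (λ p∣a → trans (n∣m⇒m%n≡0 a p p∣a) (sym 0%p))

  module _ (p-prime : Prime p) where

    1≉0 : ¬ 1 ≈ 0
    1≉0 1≈0 with trans (sym (m<n⇒m%n≡m (nonTrivial⇒n>1 p {{prime⇒nonTrivial p-prime}}))) (trans 1≈0 0%p)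
    ... | ()

    *≈0⇒ : ∀ a b → a * b ≈ 0 → a ≈ 0 ⊎ b ≈ 0
    *≈0⇒ a b ab≈0 with euclidsLemma a b p-prime (Equivalence.to (≈0⇔∣ (a * b)) ab≈0)
    ... | inj₁ p∣a = inj₁ (Equivalence.from (≈0⇔∣ a) p∣a)
    ... | inj₂ p∣b = inj₂ (Equivalence.from (≈0⇔∣ b) p∣b)

    coprime : ∀ {a} → ¬ a ≈ 0 → Coprime a p
    coprime {a} a≉0 (d∣a , d∣p) with prime⇒irreducible p-prime d∣p
    ... | inj₁ d≡1 = d≡1
    ... | inj₂ refl = contradiction (Equivalence.from (≈0⇔∣ a) d∣a) a≉0

    inverse : ∀ {a} → ¬ a ≈ 0 → ∃ λ a⁻¹ → a * a⁻¹ ≈ 1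
    inverse {a} a≉0 with coprime-Bézout (coprime a≉0)
    ... | Bézout.+- x y 1+yp≡xa = x , (begin
      (a * x) % p       ≡⟨ cong (_% p) (trans (*-comm a x) (sym 1+yp≡xa)) ⟩
      (1 + y * p) % p   ≡⟨ +-*p-≈ 1 y ⟩
      1 % p             ∎)
    ... | Bézout.-+ x y 1+xa≡yp = neg x , +-cancelʳ-≈ (x * a) (begin
      (a * neg x + x * a) % p  ≡⟨ cong (_% p) (solve 3 (λ a m x → a :* (m :* x) :+ x :* a := (m :* x :+ x) :* a)
                                                       refl a (p ∸ 1) x) ⟩
      ((neg x + x) * a) % p    ≡⟨ *-congʳ a (neg-inverseˡ x) ⟩
      (0 * a) % p              ≡⟨ +-*p-≈ 0 y ⟨
      (0 + y * p) % p          ≡⟨ cong (_% p) 1+xa≡yp ⟨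
      (1 + x * a) % p          ∎)

    *-cancelʳ-≈ : ∀ {x y} a → ¬ a ≈ 0 → x * a ≈ y * a → x ≈ y
    *-cancelʳ-≈ {x} {y} a a≉0 xa≈ya = begin
      x % p                 ≡⟨ undo x ⟨
      (x * a * a⁻¹) % p     ≡⟨ *-congʳ a⁻¹ xa≈ya ⟩
      (y * a * a⁻¹) % p     ≡⟨ undo y ⟩
      y % p                 ∎
      where
      a⁻¹ = proj₁ (inverse a≉0)
      undo : ∀ z → z * a * a⁻¹ ≈ z
      undo z = trans (cong (_% p) (*-assoc z a a⁻¹))
                     (trans (*-congˡ z (proj₂ (inverse a≉0))) (cong (_% p) (*-identityʳ z)))

    linear-root : ∀ {a} → ¬ a ≈ 0 → ∀ c → ∃ λ (r : F p) → ∀ t → (toℕ t * a + c ≈ 0) ⇔ (t ≡ r)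
    linear-root {a} a≉0 c = r , λ t → mk⇔ (λ t-root → toℕ-≈-injective (*-cancelʳ-≈ a a≉0 (+-cancelʳ-≈ c
                                                         (trans t-root (sym r-root)))))
                                          (λ { refl → r-root })
      where
      a⁻¹ = proj₁ (inverse a≉0)
      r : F p
      r = (neg c * a⁻¹) mod p
      r-root : toℕ r * a + c ≈ 0
      r-root = begin
        (toℕ r * a + c) % p          ≡⟨ +-cong (*-congʳ a (toℕ-mod (neg c * a⁻¹))) (refl {x = c % p}) ⟩
        (neg c * a⁻¹ * a + c) % p    ≡⟨ cong (λ z → (z + c) % p) (solve 3 (λ n i a → n :* i :* a := n :* (a :* i))
                                                                              refl (neg c) a⁻¹ a) ⟩
        (neg c * (a * a⁻¹) + c) % p  ≡⟨ +-cong (*-congˡ (neg c) (proj₂ (inverse a≉0))) (refl {x = c % p}) ⟩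
        (neg c * 1 + c) % p          ≡⟨ cong (λ z → (z + c) % p) (*-identityʳ (neg c)) ⟩
        (neg c + c) % p              ≡⟨ neg-inverseˡ c ⟩
        0 % p                        ∎

module Translation (p : ℕ) .{{_ : NonZero p}} where

  open Modular p

  translation : ℕ → F p ↔ F p
  translation a = mk↔ₛ′ (λ s → (a + toℕ s) mod p) (λ t → (toℕ t + neg a) mod p) back forth
    where
    open ≡-Reasoning
    back : ∀ t → (a + toℕ ((toℕ t + neg a) mod p)) mod p ≡ t
    back t = toℕ-≈-injective (begin
      toℕ ((a + toℕ ((toℕ t + neg a) mod p)) mod p) % p ≡⟨ toℕ-mod _ ⟩
      (a + toℕ ((toℕ t + neg a) mod p)) % p             ≡⟨ +-congˡ a (toℕ-mod _) ⟩
      (a + (toℕ t + neg a)) % p                         ≡⟨ cong (_% p) (solve 3 (λ a t n → a :+ (t :+ n) := t :+ (n :+ a))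
                                                                                refl a (toℕ t) (neg a)) ⟩
      (toℕ t + (neg a + a)) % p                         ≡⟨ +-congˡ (toℕ t) (neg-inverseˡ a) ⟩
      (toℕ t + 0) % p                                   ≡⟨ cong (_% p) (+-identityʳ (toℕ t)) ⟩
      toℕ t % p                                         ∎)
    forth : ∀ s → (toℕ ((a + toℕ s) mod p) + neg a) mod p ≡ s
    forth s = toℕ-≈-injective (begin
      toℕ ((toℕ ((a + toℕ s) mod p) + neg a) mod p) % p ≡⟨ toℕ-mod _ ⟩
      (toℕ ((a + toℕ s) mod p) + neg a) % p             ≡⟨ +-cong (toℕ-mod (a + toℕ s)) refl ⟩
      (a + toℕ s + neg a) % p                           ≡⟨ cong (_% p) (solve 3 (λ a s n → a :+ s :+ n := s :+ (a :+ n))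
                                                                                refl a (toℕ s) (neg a)) ⟩
      (toℕ s + (a + neg a)) % p                         ≡⟨ +-congˡ (toℕ s) (neg-inverseʳ a) ⟩
      (toℕ s + 0) % p                                   ≡⟨ cong (_% p) (+-identityʳ (toℕ s)) ⟩
      toℕ s % p                                         ∎)

  ∑-translate : ∀ a (h : F p → ℕ) → ∑ (allFin p) h ≡ ∑[ j < p ] h ((a + j) mod p)
  ∑-translate a h = begin
    ∑ (allFin p) h                          ≡⟨ ∑-reindex Fin._≟_ Fin._≟_ (translation a) Fp Fp h ⟨
    ∑[ s ∈ allFin p ] h ((a + toℕ s) mod p) ≡⟨ ∑-allFin-toℕ p (λ j → h ((a + j) mod p)) ⟩
    ∑[ j < p ] h ((a + j) mod p)            ∎
    where
    open ≡-Reasoning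
    Fp = enumerates-allFin p

-- Vectors and hyperplanes

module Vectors (p : ℕ) .{{_ : NonZero p}} where

  open Modular p
  open ≡-Reasoning

  infixl 6 _+ᵥ_
  infixr 7 _·ᵥ_

  _+ᵥ_ : ∀ {d} → Vec (F p) d → Vec (F p) d → Vec (F p) d
  _+ᵥ_ = _+V_ p

  _·ᵥ_ : ∀ {d} → ℕ → Vec (F p) d → Vec (F p) d
  _·ᵥ_ = _·V_ p

  0ᵥ : ∀ d → Vec (F p) d
  0ᵥ = 0V p

  dotℕ : ∀ {d} → Vec (F p) d → Vec (F p) d → ℕ
  dotℕ []       []       = 0
  dotℕ (a ∷ as) (x ∷ xs) = toℕ a * toℕ x + dotℕ as xs

  toℕ-dot : ∀ {d} (a x : Vec (F p) d) → toℕ (dot p a x) ≈ dotℕ a x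
  toℕ-dot []       []       = cong (_% p) toℕ-0F
  toℕ-dot (a ∷ as) (x ∷ xs) =
    trans (toℕ-+F (_*F_ p a x) (dot p as xs)) (+-cong (toℕ-*F a x) (toℕ-dot as xs))

  ∈Hyp⇔ : ∀ {d} (a x : Vec (F p) d) → _∈_ p x (Hyp p a) ⇔ dotℕ a x ≈ 0
  ∈Hyp⇔ a x = mk⇔ (λ x∈H → trans (sym (toℕ-dot a x)) (cong (_% p) (to x∈H)))
                   (λ a·x≈0 → from (toℕ-≈0 (dot p a x) (trans (toℕ-dot a x) a·x≈0)))
    where open Equivalence (≡ᵇ0⇔≡0 (toℕ (dot p a x)))

  Hyp-cong : ∀ {d e} (a x : Vec (F p) d) (b y : Vec (F p) e) →
             dotℕ a x ≈ 0 ⇔ dotℕ b y ≈ 0 → Hyp p a x ≡ Hyp p b y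
  Hyp-cong a x b y a·x⇔b·y = ≡true⇔⇒≡ (⇔-sym (∈Hyp⇔ b y) ⇔-∘ (a·x⇔b·y ⇔-∘ ∈Hyp⇔ a x))

  Hyp-≈ : ∀ {d e} (a x : Vec (F p) d) (b y : Vec (F p) e) → dotℕ a x ≈ dotℕ b y → Hyp p a x ≡ Hyp p b y
  Hyp-≈ a x b y a·x≈b·y = Hyp-cong a x b y (≈0-cong a·x≈b·y)

  dotℕ-+ʳ : ∀ {d} (a x y : Vec (F p) d) → dotℕ a (x +ᵥ y) ≈ dotℕ a x + dotℕ a y
  dotℕ-+ʳ []       []       []       = refl
  dotℕ-+ʳ (a ∷ as) (x ∷ xs) (y ∷ ys) = trans
    (+-cong (*-congˡ (toℕ a) (toℕ-+F x y)) (dotℕ-+ʳ as xs ys))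
    (cong (_% p) (solve 5 (λ a x y d e → a :* (x :+ y) :+ (d :+ e) := (a :* x :+ d) :+ (a :* y :+ e))
                          refl (toℕ a) (toℕ x) (toℕ y) (dotℕ as xs) (dotℕ as ys)))

  dotℕ-·ʳ : ∀ {d} (a x : Vec (F p) d) k → dotℕ a (k ·ᵥ x) ≈ k * dotℕ a x
  dotℕ-·ʳ []       []       k = cong (_% p) (sym (*-zeroʳ k))
  dotℕ-·ʳ (a ∷ as) (x ∷ xs) k = trans
    (+-cong (*-congˡ (toℕ a) (toℕ-mod (k * toℕ x))) (dotℕ-·ʳ as xs k))
    (cong (_% p) (solve 4 (λ a x k d → a :* (k :* x) :+ k :* d := k :* (a :* x :+ d))
                          refl (toℕ a) (toℕ x) k (dotℕ as xs)))

  dotℕ-·ˡ : ∀ {d} (a x : Vec (F p) d) k → dotℕ (k ·ᵥ a) x ≈ k * dotℕ a x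
  dotℕ-·ˡ []       []       k = cong (_% p) (sym (*-zeroʳ k))
  dotℕ-·ˡ (a ∷ as) (x ∷ xs) k = trans
    (+-cong (*-congʳ (toℕ x) (toℕ-mod (k * toℕ a))) (dotℕ-·ˡ as xs k))
    (cong (_% p) (solve 4 (λ a x k d → k :* a :* x :+ k :* d := k :* (a :* x :+ d))
                          refl (toℕ a) (toℕ x) k (dotℕ as xs)))

  dotℕ-insertAt : ∀ {d} (a x : Vec (F p) d) i α ξ →
                  dotℕ (insertAt a i α) (insertAt x i ξ) ≡ toℕ α * toℕ ξ + dotℕ a x
  dotℕ-insertAt a        x        zero    α ξ = refl
  dotℕ-insertAt (a ∷ as) (x ∷ xs) (suc i) α ξ =
    trans (cong (toℕ a * toℕ x +_) (dotℕ-insertAt as xs i α ξ))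
          (solve 3 (λ u v w → u :+ (v :+ w) := v :+ (u :+ w)) refl (toℕ a * toℕ x) (toℕ α * toℕ ξ) (dotℕ as xs))

  dotℕ-0ˡ : ∀ {d} (x : Vec (F p) d) → dotℕ (0ᵥ d) x ≡ 0
  dotℕ-0ˡ []       = refl
  dotℕ-0ˡ (x ∷ xs) = trans (cong (λ z → z * toℕ x + dotℕ (0ᵥ _) xs) toℕ-0F) (dotℕ-0ˡ xs)

  lookup-+ᵥ : ∀ {d} (v w : Vec (F p) d) i → toℕ (lookup (v +ᵥ w) i) ≈ toℕ (lookup v i) + toℕ (lookup w i)
  lookup-+ᵥ v w i =
    trans (cong (λ z → toℕ z % p) (lookup-zipWith (_+F_ p) i v w)) (toℕ-+F (lookup v i) (lookup w i))

  lookup-·ᵥ : ∀ {d} k (w : Vec (F p) d) i → toℕ (lookup (k ·ᵥ w) i) ≈ k * toℕ (lookup w i)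
  lookup-·ᵥ k w i = trans (cong (λ z → toℕ z % p) (lookup-map i _ w)) (toℕ-mod (k * toℕ (lookup w i)))

  toℕ-lookup-0ᵥ : ∀ {d} (i : Fin d) → toℕ (lookup (0ᵥ d) i) ≡ 0
  toℕ-lookup-0ᵥ i = trans (cong toℕ (lookup-replicate i (0F p))) toℕ-0F

  ≈-ext : ∀ {d} {v w : Vec (F p) d} → (∀ i → toℕ (lookup v i) ≈ toℕ (lookup w i)) → v ≡ w
  ≈-ext {v = []}    {[]}    v≈w = refl
  ≈-ext {v = a ∷ v} {b ∷ w} v≈w = cong₂ _∷_ (toℕ-≈-injective (v≈w zero)) (≈-ext (v≈w ∘ suc))

  lookup-+ᵥ-·ᵥ : ∀ {d} (v w : Vec (F p) d) s i →
                 toℕ (lookup (v +ᵥ s ·ᵥ w) i) ≈ toℕ (lookup v i) + s * toℕ (lookup w i)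
  lookup-+ᵥ-·ᵥ v w s i = trans (lookup-+ᵥ v (s ·ᵥ w) i) (+-congˡ (toℕ (lookup v i)) (lookup-·ᵥ s w i))

  +ᵥ-·ᵥ-merge : ∀ {d} (v w : Vec (F p) d) s r {t} → s + r ≈ t → v +ᵥ s ·ᵥ w +ᵥ r ·ᵥ w ≡ v +ᵥ t ·ᵥ w
  +ᵥ-·ᵥ-merge v w s r {t} s+r≈t = ≈-ext λ i → let vᵢ = toℕ (lookup v i); wᵢ = toℕ (lookup w i) in begin
    toℕ (lookup (v +ᵥ s ·ᵥ w +ᵥ r ·ᵥ w) i) % p  ≡⟨ lookup-+ᵥ-·ᵥ (v +ᵥ s ·ᵥ w) w r i ⟩
    (toℕ (lookup (v +ᵥ s ·ᵥ w) i) + r * wᵢ) % p ≡⟨ +-cong (lookup-+ᵥ-·ᵥ v w s i) (refl {x = (r * wᵢ) % p}) ⟩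
    (vᵢ + s * wᵢ + r * wᵢ) % p                  ≡⟨ cong (_% p) (trans (+-assoc vᵢ _ _)
                                                                      (cong (vᵢ +_) (sym (*-distribʳ-+ wᵢ s r)))) ⟩
    (vᵢ + (s + r) * wᵢ) % p                     ≡⟨ +-congˡ vᵢ (*-congʳ wᵢ s+r≈t) ⟩
    (vᵢ + t * wᵢ) % p                           ≡⟨ lookup-+ᵥ-·ᵥ v w t i ⟨
    toℕ (lookup (v +ᵥ t ·ᵥ w) i) % p            ∎

  +ᵥ-0·ᵥ : ∀ {d} (v w : Vec (F p) d) → v +ᵥ 0 ·ᵥ w ≡ v
  +ᵥ-0·ᵥ v w = ≈-ext λ i → trans (lookup-+ᵥ-·ᵥ v w 0 i) (cong (_% p) (+-identityʳ (toℕ (lookup v i))))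

  +ᵥ-·ᵥ-cancel : ∀ {d} (v w : Vec (F p) d) s r → s + r ≈ 0 → v +ᵥ s ·ᵥ w +ᵥ r ·ᵥ w ≡ v
  +ᵥ-·ᵥ-cancel v w s r s+r≈0 = trans (+ᵥ-·ᵥ-merge v w s r s+r≈0) (+ᵥ-0·ᵥ v w)

  +ᵥ-identityˡ : ∀ {d} (v : Vec (F p) d) → 0ᵥ d +ᵥ v ≡ v
  +ᵥ-identityˡ v = ≈-ext λ i →
    trans (lookup-+ᵥ (0ᵥ _) v i) (cong (λ z → (z + toℕ (lookup v i)) % p) (toℕ-lookup-0ᵥ i))

  insertAt-0ᵥ : ∀ d (i : Fin (suc d)) → insertAt (0ᵥ d) i (0F p) ≡ 0ᵥ (suc d)
  insertAt-0ᵥ d       zero    = refl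
  insertAt-0ᵥ (suc d) (suc i) = cong (0F p ∷_) (insertAt-0ᵥ d i)

  removeAt-0ᵥ : ∀ d (i : Fin (suc d)) → removeAt (0ᵥ (suc d)) i ≡ 0ᵥ d
  removeAt-0ᵥ d i =
    trans (cong (λ v → removeAt v i) (sym (insertAt-0ᵥ d i))) (removeAt-insertAt (0ᵥ d) i (0F p))

  nonzero-coordinate : ∀ {d} {v : Vec (F p) d} → ¬ v ≡ 0ᵥ d → ∃ λ i → ¬ lookup v i ≡ 0F p
  nonzero-coordinate {d} {v} v≢0 = ¬∀⟶∃¬ d (λ i → lookup v i ≡ 0F p) (λ i → lookup v i Fin.≟ 0F p)
    λ all-zero → v≢0 (≈-ext λ i → cong (λ x → toℕ x % p) (trans (all-zero i) (sym (lookup-replicate i (0F p)))))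

-- Masses of hyperplanes and pencils

module HyperplaneMass (p : ℕ) .{{_ : NonZero p}} (p-prime : Prime p) where

  open Modular p
  open Vectors p

  mass : ∀ {d} → (Vec (F p) d → ℕ) → ℕ
  mass {d} g = ∑ (allVecs p d) g

  massOn : ∀ {d} → (Vec (F p) d → ℕ) → Vec (F p) d → ℕ
  massOn {d} g b = ∑[ y ∈ allVecs p d ] (⟦ Hyp p b y ⟧ * g y)

  Good : ∀ {d} → (Vec (F p) d → ℕ) → Vec (F p) d → Set
  Good g b = mass g ≤ p * massOn g b

  Distinct : ∀ {d} → Vec (F p) d → Vec (F p) d → Set
  Distinct a b = ¬ (∀ x → _∈_ p x (Hyp p a) ⇔ _∈_ p x (Hyp p b))

  record TwoGoodHyperplanes {d} (g : Vec (F p) d → ℕ) : Set where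
    field
      b₁ b₂    : Vec (F p) d
      b₁≢0     : ¬ b₁ ≡ 0ᵥ d
      b₂≢0     : ¬ b₂ ≡ 0ᵥ d
      distinct : Distinct b₁ b₂
      good₁    : Good g b₁
      good₂    : Good g b₂

  slice : ∀ {d} → (Vec (F p) (suc d) → ℕ) → Vec (F p) d → ℕ
  slice g z = g (0F p ∷ z)

  on-slice : ∀ {d} → Vec (F p) (suc d) → ℕ
  on-slice y = δ Fin._≟_ (head y) (0F p)

  ∑-slice : ∀ {d} (h : Vec (F p) (suc d) → ℕ) →
            ∑[ z ∈ allVecs p d ] h (0F p ∷ z) ≡ ∑[ y ∈ allVecs p (suc d) ] (on-slice y * h y)
  ∑-slice {d} h = begin
    ∑[ z ∈ allVecs p d ] h (0F p ∷ z)
      ≡⟨ ∑-δ Fin._≟_ (enumerates-allFin p) (0F p) _ ⟨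
    ∑[ a ∈ allFin p ] (δ Fin._≟_ a (0F p) * ∑[ z ∈ allVecs p d ] h (a ∷ z))
      ≡⟨ ∑-cong (allFin p) (λ a → ∑-*ˡ (allVecs p d) (δ Fin._≟_ a (0F p)) _) ⟨
    ∑[ a ∈ allFin p ] ∑[ z ∈ allVecs p d ] (δ Fin._≟_ a (0F p) * h (a ∷ z))
      ≡⟨ ∑-allVecs-suc p (λ y → on-slice y * h y) ⟨
    ∑[ y ∈ allVecs p (suc d) ] (on-slice y * h y) ∎
    where open ≡-Reasoning

  Hyp-slice : ∀ {d} t (b z : Vec (F p) d) → Hyp p (t ∷ b) (0F p ∷ z) ≡ Hyp p b z
  Hyp-slice t b z = Hyp-≈ (t ∷ b) (0F p ∷ z) b z (cong (_% p) (begin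
    toℕ t * toℕ (0F p) + dotℕ b z ≡⟨ cong (λ w → toℕ t * w + dotℕ b z) toℕ-0F ⟩
    toℕ t * 0 + dotℕ b z          ≡⟨ cong (_+ dotℕ b z) (*-zeroʳ (toℕ t)) ⟩
    dotℕ b z                      ∎))
    where open ≡-Reasoning

  -- The hyperplanes t ∷ b (t ∈ F_p) and the slice y₀ = 0 form the pencil through
  -- {0} × (b ⊥).  A point with y₀ ≢ 0 lies on exactly one t ∷ b, the root of t y₀ + b · z.
  pencil-multiplicity : ∀ {d} (b : Vec (F p) d) (y : Vec (F p) (suc d)) →
    ∑[ t ∈ allFin p ] ⟦ Hyp p (t ∷ b) y ⟧ + on-slice y ≡ 1 + p * (on-slice y * ⟦ Hyp p b (tail y) ⟧)
  pencil-multiplicity b (y₀ ∷ z) with y₀ Fin.≟ 0F p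
  ... | yes refl = begin
    ∑[ t ∈ allFin p ] ⟦ Hyp p (t ∷ b) (0F p ∷ z) ⟧ + 1
      ≡⟨ cong (_+ 1) (∑-cong (allFin p) (λ t → cong ⟦_⟧ (Hyp-slice t b z))) ⟩
    ∑[ t ∈ allFin p ] ⟦ Hyp p b z ⟧ + 1
      ≡⟨ cong (_+ 1) (∑-allFin-const p _) ⟩
    p * ⟦ Hyp p b z ⟧ + 1
      ≡⟨ solve 2 (λ p h → p :* h :+ con 1 := con 1 :+ p :* (con 1 :* h)) refl p ⟦ Hyp p b z ⟧ ⟩
    1 + p * (1 * ⟦ Hyp p b z ⟧) ∎
    where open ≡-Reasoning
  ... | no y₀≢0 = begin
    ∑[ t ∈ allFin p ] ⟦ Hyp p (t ∷ b) (y₀ ∷ z) ⟧ + 0 ≡⟨ cong (_+ 0) one-root ⟩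
    1 + 0                                            ≡⟨ cong (1 +_) (*-zeroʳ p) ⟨
    1 + p * (0 * ⟦ Hyp p b z ⟧)                      ∎
    where
    open ≡-Reasoning
    root = linear-root p-prime (≢0F⇒≉0 y₀≢0) (dotℕ b z)
    one-root : ∑[ t ∈ allFin p ] ⟦ Hyp p (t ∷ b) (y₀ ∷ z) ⟧ ≡ 1
    one-root = ∑-⟦⟧≡1 Fin._≟_ (enumerates-allFin p) (λ t → Hyp p (t ∷ b) (y₀ ∷ z)) (proj₁ root)
                      (λ t → proj₂ root t ⇔-∘ ∈Hyp⇔ (t ∷ b) (y₀ ∷ z))

  pencil : ∀ {d} (g : Vec (F p) (suc d) → ℕ) (b : Vec (F p) d) →
           ∑[ t ∈ allFin p ] massOn g (t ∷ b) + mass (slice g) ≡ mass g + p * massOn (slice g) b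
  pencil {d} g b = begin
    ∑[ t ∈ allFin p ] massOn g (t ∷ b) + mass (slice g)
      ≡⟨ cong₂ _+_ (∑-comm (allFin p) V _) (∑-slice g) ⟩
    ∑[ y ∈ V ] ∑[ t ∈ allFin p ] (⟦ Hyp p (t ∷ b) y ⟧ * g y) + ∑[ y ∈ V ] (on-slice y * g y)
      ≡⟨ cong (_+ ∑[ y ∈ V ] (on-slice y * g y)) (∑-cong V (λ y → ∑-*ʳ (allFin p) (g y) _)) ⟩
    ∑[ y ∈ V ] (multiplicity y * g y) + ∑[ y ∈ V ] (on-slice y * g y)
      ≡⟨ ∑-distrib-+ V _ _ ⟨
    ∑[ y ∈ V ] (multiplicity y * g y + on-slice y * g y)
      ≡⟨ ∑-cong V (λ y → trans (sym (*-distribʳ-+ (g y) (multiplicity y) (on-slice y)))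
                                (cong (_* g y) (pencil-multiplicity b y))) ⟩
    ∑[ y ∈ V ] ((1 + p * (on-slice y * ⟦ Hyp p b (tail y) ⟧)) * g y)
      ≡⟨ ∑-cong V (λ y → solve 4 (λ p a h g → (con 1 :+ p :* (a :* h)) :* g := g :+ p :* (a :* (h :* g)))
                                refl p (on-slice y) ⟦ Hyp p b (tail y) ⟧ (g y)) ⟩
    ∑[ y ∈ V ] (g y + p * (on-slice y * (⟦ Hyp p b (tail y) ⟧ * g y)))
      ≡⟨ trans (∑-distrib-+ V g _) (cong (mass g +_) (∑-*ˡ V p _)) ⟩
    mass g + p * ∑[ y ∈ V ] (on-slice y * (⟦ Hyp p b (tail y) ⟧ * g y))
      ≡⟨ cong (λ m → mass g + p * m) (∑-slice (λ y → ⟦ Hyp p b (tail y) ⟧ * g y)) ⟨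
    mass g + p * massOn (slice g) b ∎
    where
    open ≡-Reasoning
    V = allVecs p (suc d)
    multiplicity : Vec (F p) (suc d) → ℕ
    multiplicity y = ∑[ t ∈ allFin p ] ⟦ Hyp p (t ∷ b) y ⟧

  one : F p
  one = 1 mod p

  one≢0F : ¬ one ≡ 0F p
  one≢0F one≡0 = 1≉0 p-prime (trans (sym (toℕ-mod 1)) (Equivalence.from (toℕ≈0⇔≡0F one) one≡0))

  dotℕ-axis : ∀ {d} y₀ (z : Vec (F p) d) → dotℕ (one ∷ 0ᵥ d) (y₀ ∷ z) ≈ toℕ y₀
  dotℕ-axis {d} y₀ z = begin
    (toℕ one * toℕ y₀ + dotℕ (0ᵥ d) z) % p ≡⟨ cong (λ w → (toℕ one * toℕ y₀ + w) % p) (dotℕ-0ˡ z) ⟩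
    (toℕ one * toℕ y₀ + 0) % p             ≡⟨ +-cong (*-congʳ (toℕ y₀) (toℕ-mod 1)) refl ⟩
    (1 * toℕ y₀ + 0) % p                   ≡⟨ cong (_% p) (trans (+-identityʳ _) (*-identityˡ _)) ⟩
    toℕ y₀ % p                             ∎
    where open ≡-Reasoning

  massOn-slice-hyperplane : ∀ {d} (g : Vec (F p) (suc d) → ℕ) → massOn g (one ∷ 0ᵥ d) ≡ mass (slice g)
  massOn-slice-hyperplane {d} g =
    trans (∑-cong (allVecs p (suc d)) (λ y → cong (_* g y) (Hyp≡on-slice y))) (sym (∑-slice g))
    where
    Hyp≡on-slice : ∀ y → ⟦ Hyp p (one ∷ 0ᵥ d) y ⟧ ≡ on-slice y
    Hyp≡on-slice (y₀ ∷ z) =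
      ⟦⟧≡δ Fin._≟_ (toℕ≈0⇔≡0F y₀ ⇔-∘ (≈0-cong (dotℕ-axis y₀ z) ⇔-∘ ∈Hyp⇔ (one ∷ 0ᵥ d) (y₀ ∷ z)))

  mass-const : ∀ d k → mass {d} (λ _ → k) ≡ p ^ d * k
  mass-const zero    k = refl
  mass-const (suc d) k = begin
    ∑[ y ∈ allVecs p (suc d) ] k             ≡⟨ ∑-allVecs-suc p (λ _ → k) ⟩
    ∑[ a ∈ allFin p ] ∑[ z ∈ allVecs p d ] k ≡⟨ ∑-cong (allFin p) (λ _ → mass-const d k) ⟩
    ∑[ a ∈ allFin p ] (p ^ d * k)            ≡⟨ ∑-allFin-const p (p ^ d * k) ⟩
    p * (p ^ d * k)                          ≡⟨ *-assoc p (p ^ d) k ⟨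
    p ^ suc d * k                            ∎
    where open ≡-Reasoning

  mass-≤ : ∀ {d m} (g : Vec (F p) d → ℕ) → (∀ y → g y ≤ m) → mass g ≤ p ^ d * m
  mass-≤ {d} {m} g g≤m = ≤-trans (∑-mono-≤ (allVecs p d) g≤m) (≤-reflexive (mass-const d m))

  massOn-≤ : ∀ {d m} (g : Vec (F p) d → ℕ) → (∀ y → g y ≤ m) → ∀ b →
             massOn g b ≤ mass (λ y → ⟦ Hyp p b y ⟧) * m
  massOn-≤ {d} {m} g g≤m b = ≤-trans (∑-mono-≤ (allVecs p d) (λ y → *-monoʳ-≤ ⟦ Hyp p b y ⟧ (g≤m y)))
                                     (≤-reflexive (∑-*ʳ (allVecs p d) m _))

  good-extends : ∀ {d} (g : Vec (F p) (suc d) → ℕ) {b} → Good (slice g) b → ∃ λ t → Good g (t ∷ b)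
  good-extends g {b} good with ∃-≥-mean (allFin p) (λ t → massOn g (t ∷ b)) (mass g) 0<length mass≤∑
    where
    0<length = subst (0 <_) (sym (length-allFin p)) (>-nonZero⁻¹ p)
    mass≤∑ : mass g ≤ ∑[ t ∈ allFin p ] massOn g (t ∷ b)
    mass≤∑ = +-cancelʳ-≤ (mass (slice g)) (mass g) _
               (≤-trans (+-monoʳ-≤ (mass g) good) (≤-reflexive (sym (pencil g b))))
  ... | t , good-t = t , subst (λ n → mass g ≤ n * massOn g (t ∷ b)) (length-allFin p) good-t

  two-good-extends : ∀ {d} (g : Vec (F p) (suc d) → ℕ) → TwoGoodHyperplanes (slice g) → TwoGoodHyperplanes g
  two-good-extends g H = record
    { b₁       = proj₁ extend₁ ∷ b₁
    ; b₂       = proj₁ extend₂ ∷ b₂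
    ; b₁≢0     = λ eq → b₁≢0 (∷-injectiveʳ eq)
    ; b₂≢0     = λ eq → b₂≢0 (∷-injectiveʳ eq)
    ; distinct = λ same → distinct λ z →
        subst₂ (λ u v → u ≡ true ⇔ v ≡ true) (Hyp-slice (proj₁ extend₁) b₁ z) (Hyp-slice (proj₁ extend₂) b₂ z)
               (same (0F p ∷ z))
    ; good₁    = proj₂ extend₁
    ; good₂    = proj₂ extend₂
    }
    where
    open TwoGoodHyperplanes H
    extend₁ = good-extends g good₁
    extend₂ = good-extends g good₂

  line : F p → Vec (F p) 2
  line t = t ∷ one ∷ []

  axis : Vec (F p) 2
  axis = one ∷ 0ᵥ 1

  line≢0 : ∀ t → ¬ line t ≡ 0ᵥ 2
  line≢0 t eq = one≢0F (∷-injectiveˡ (∷-injectiveʳ eq))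

  axis≢0 : ¬ axis ≡ 0ᵥ 2
  axis≢0 eq = one≢0F (∷-injectiveˡ eq)

  dotℕ-line : ∀ t y₀ y₁ → dotℕ (line t) (y₀ ∷ y₁ ∷ []) ≈ toℕ t * toℕ y₀ + toℕ y₁
  dotℕ-line t y₀ y₁ = +-congˡ (toℕ t * toℕ y₀) (begin
    (toℕ one * toℕ y₁ + 0) % p ≡⟨ cong (_% p) (+-identityʳ _) ⟩
    (toℕ one * toℕ y₁) % p     ≡⟨ *-congʳ (toℕ y₁) (toℕ-mod 1) ⟩
    (1 * toℕ y₁) % p           ≡⟨ cong (_% p) (*-identityˡ (toℕ y₁)) ⟩
    toℕ y₁ % p                 ∎)
    where open ≡-Reasoning

  line-size : ∀ t → mass (λ y → ⟦ Hyp p (line t) y ⟧) ≡ p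
  line-size t = begin
    mass (λ y → ⟦ Hyp p (line t) y ⟧)
      ≡⟨ trans (∑-allVecs-suc p _) (∑-cong (allFin p) (λ y₀ → ∑-allVecs-suc p _)) ⟩
    ∑[ y₀ ∈ allFin p ] ∑[ y₁ ∈ allFin p ] (⟦ Hyp p (line t) (y₀ ∷ y₁ ∷ []) ⟧ + 0)
      ≡⟨ ∑-cong (allFin p) one-root ⟩
    ∑[ y₀ ∈ allFin p ] 1
      ≡⟨ trans (∑-allFin-const p 1) (*-identityʳ p) ⟩
    p ∎
    where
    open ≡-Reasoning
    one-root : ∀ y₀ → ∑[ y₁ ∈ allFin p ] (⟦ Hyp p (line t) (y₀ ∷ y₁ ∷ []) ⟧ + 0) ≡ 1
    one-root y₀ = trans (∑-cong (allFin p) (λ y₁ → +-identityʳ _))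
      (∑-⟦⟧≡1 Fin._≟_ (enumerates-allFin p) _ (proj₁ root) λ y₁ →
        proj₂ root y₁ ⇔-∘ (≈0-cong (trans (dotℕ-line t y₀ y₁) (cong (_% p) (rearrange y₁)))
                          ⇔-∘ ∈Hyp⇔ (line t) (y₀ ∷ y₁ ∷ [])))
      where
      root = linear-root p-prime (1≉0 p-prime) (toℕ t * toℕ y₀)
      rearrange : ∀ y₁ → toℕ t * toℕ y₀ + toℕ y₁ ≡ toℕ y₁ * 1 + toℕ t * toℕ y₀
      rearrange y₁ = solve 2 (λ c y → c :+ y := y :* con 1 :+ c) refl (toℕ t * toℕ y₀) (toℕ y₁)

  line-axis-distinct : ∀ t → Distinct (line t) axis
  line-axis-distinct t same = 1≉0 p-prime (begin
    1 % p                                ≡⟨ cong (λ w → (w + 1) % p) t·0≡0 ⟨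
    (toℕ t * toℕ (0F p) + 1) % p         ≡⟨ +-congˡ (toℕ t * toℕ (0F p)) (toℕ-mod 1) ⟨
    (toℕ t * toℕ (0F p) + toℕ one) % p   ≡⟨ dotℕ-line t (0F p) one ⟨
    dotℕ (line t) y % p                  ≡⟨ Equivalence.to (∈Hyp⇔ (line t) y) (Equivalence.from (same y) y∈axis) ⟩
    0 % p                                ∎)
    where
    open ≡-Reasoning
    y = 0F p ∷ one ∷ []
    t·0≡0 : toℕ t * toℕ (0F p) ≡ 0
    t·0≡0 = trans (cong (toℕ t *_) toℕ-0F) (*-zeroʳ (toℕ t))
    y∈axis : _∈_ p y (Hyp p axis)
    y∈axis = Equivalence.from (∈Hyp⇔ axis y) (trans (dotℕ-axis (0F p) (one ∷ [])) (cong (_% p) toℕ-0F))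

  lines-distinct : ∀ {t₁ t₂} → ¬ t₂ ≡ t₁ → Distinct (line t₁) (line t₂)
  lines-distinct {t₁} {t₂} t₂≢t₁ same =
    t₂≢t₁ (toℕ-≈-injective (+-cancelʳ-≈ (toℕ s) (trans (on-line t₂ y∈line₂) (sym (on-line t₁ y∈line₁)))))
    where
    s : F p
    s = neg (toℕ t₁) mod p
    y = one ∷ s ∷ []
    dotℕ-y : ∀ t → dotℕ (line t) y ≈ toℕ t + toℕ s
    dotℕ-y t = trans (dotℕ-line t one s) (+-cong (trans (*-congˡ (toℕ t) (toℕ-mod 1))
                                                        (cong (_% p) (*-identityʳ (toℕ t)))) refl)
    on-line : ∀ t → _∈_ p y (Hyp p (line t)) → toℕ t + toℕ s ≈ 0
    on-line t y∈line = trans (sym (dotℕ-y t)) (Equivalence.to (∈Hyp⇔ (line t) y) y∈line)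
    y∈line₁ : _∈_ p y (Hyp p (line t₁))
    y∈line₁ = Equivalence.from (∈Hyp⇔ (line t₁) y)
      (trans (dotℕ-y t₁) (trans (+-congˡ (toℕ t₁) (toℕ-mod (neg (toℕ t₁)))) (neg-inverseʳ (toℕ t₁))))
    y∈line₂ = Equivalence.to (same y) y∈line₁

  pencil-bound : ∀ {∑f S₀ S P f₁} → ∑f + S₀ ≡ S + P → p * ∑f + S ≤ p * f₁ + p * S → f₁ ≤ P →
                 S ≤ p * S₀
  pencil-bound {∑f} {S₀} {S} {P} {f₁} pencil-eq off-one f₁≤P = +-cancelˡ-≤ (p * ∑f) S (p * S₀) (begin
    p * ∑f + S      ≤⟨ off-one ⟩
    p * f₁ + p * S  ≤⟨ +-monoˡ-≤ (p * S) (*-monoʳ-≤ p f₁≤P) ⟩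
    p * P + p * S   ≡⟨ trans (+-comm (p * P) (p * S)) (sym (*-distribˡ-+ p S P)) ⟩
    p * (S + P)     ≡⟨ cong (p *_) pencil-eq ⟨
    p * (∑f + S₀)   ≡⟨ *-distribˡ-+ p ∑f S₀ ⟩
    p * ∑f + p * S₀ ∎)
    where open ≤-Reasoning

  module Plane {m} (g : Vec (F p) 2 → ℕ) (g≤m : ∀ y → g y ≤ m) (m≤g₀ : m ≤ g (0ᵥ 2)) where

    P : ℕ
    P = p * massOn (slice g) (one ∷ [])

    pm≤P : p * m ≤ P
    pm≤P = *-monoʳ-≤ p (≤-trans m≤g₀ (≤-trans (m≤m+n _ 0)
                         (≤-reflexive (sym (massOn-slice-hyperplane (slice g))))))

    slice-good : Good (slice g) (one ∷ [])
    slice-good = ≤-trans (mass-≤ (slice g) (λ z → g≤m (0F p ∷ z)))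
                         (≤-trans (≤-reflexive (cong (_* m) (*-identityʳ p))) pm≤P)

    line-mass-≤ : ∀ t → massOn g (line t) ≤ P
    line-mass-≤ t = ≤-trans (massOn-≤ g g≤m (line t)) (≤-trans (≤-reflexive (cong (_* m) (line-size t))) pm≤P)

    -- If neither the axis nor any line but t₁ were good, the pencil through 0 would make the axis good.
    second-good-line : ∀ t₁ → ¬ Good g axis → ∃ λ t₂ → ¬ t₂ ≡ t₁ × Good g (line t₂)
    second-good-line t₁ axis-bad with any? (λ t → ¬? (t Fin.≟ t₁) ×-dec (mass g ≤? p * massOn g (line t)))
    ... | yes found = found
    ... | no none   = contradiction (subst (λ S₀ → mass g ≤ p * S₀) (sym (massOn-slice-hyperplane g))
                                      (pencil-bound (pencil g (one ∷ [])) off-one (line-mass-≤ t₁)))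
                                    axis-bad
      where
      n = length (allFin p)
      others-bad : ∀ t → ¬ t ≡ t₁ → n * massOn g (line t) ≤ mass g
      others-bad t t≢t₁ = subst (λ n → n * massOn g (line t) ≤ mass g) (sym (length-allFin p))
                                (<⇒≤ (≰⇒> (λ good → none (t , t≢t₁ , good))))
      off-one : p * ∑[ t ∈ allFin p ] massOn g (line t) + mass g ≤ p * massOn g (line t₁) + p * mass g
      off-one = subst (λ n → n * ∑[ t ∈ allFin p ] massOn g (line t) + mass g ≤ n * massOn g (line t₁) + n * mass g)
                      (length-allFin p)
                      (∑-≤-off-one Fin._≟_ (enumerates-allFin p) t₁ (λ t → massOn g (line t)) (mass g) others-bad)

    two-good-lines : TwoGoodHyperplanes g
    two-good-lines with good-extends g slice-good
    ... | t₁ , good₁ with mass g ≤? p * massOn g axis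
    ...   | yes axis-good = record
      { b₁ = line t₁ ; b₂ = axis ; b₁≢0 = line≢0 t₁ ; b₂≢0 = axis≢0
      ; distinct = line-axis-distinct t₁ ; good₁ = good₁ ; good₂ = axis-good }
    ...   | no axis-bad with second-good-line t₁ axis-bad
    ...     | t₂ , t₂≢t₁ , good₂ = record
      { b₁ = line t₁ ; b₂ = line t₂ ; b₁≢0 = line≢0 t₁ ; b₂≢0 = line≢0 t₂
      ; distinct = lines-distinct t₂≢t₁ ; good₁ = good₁ ; good₂ = good₂ }

  two-good-hyperplanes : ∀ e {m} (g : Vec (F p) (2 + e) → ℕ) → (∀ y → g y ≤ m) → m ≤ g (0ᵥ (2 + e)) →
                         TwoGoodHyperplanes g
  two-good-hyperplanes zero    g g≤m m≤g₀ = Plane.two-good-lines g g≤m m≤g₀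
  two-good-hyperplanes (suc e) g g≤m m≤g₀ =
    two-good-extends g (two-good-hyperplanes e (slice g) (λ z → g≤m (0F p ∷ z)) m≤g₀)

-- The lines parallel to u

module Fibration (p : ℕ) .{{_ : NonZero p}} (p-prime : Prime p)
                 {d} (u : Vec (F p) (suc d)) (i : Fin (suc d)) (uᵢ≢0 : ¬ lookup u i ≡ 0F p) where

  open Modular p
  open Vectors p
  open HyperplaneMass p p-prime

  c : ℕ
  c = toℕ (lookup u i)

  c≉0 : ¬ c ≈ 0
  c≉0 = ≢0F⇒≉0 uᵢ≢0

  c⁻¹ : ℕ
  c⁻¹ = proj₁ (inverse p-prime c≉0)

  cc⁻¹≈1 : c * c⁻¹ ≈ 1
  cc⁻¹≈1 = proj₂ (inverse p-prime c≉0)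

  fibre-point : Vec (F p) d → F p → Vec (F p) (suc d)
  fibre-point y t = insertAt y i (0F p) +ᵥ toℕ t ·ᵥ u

  coefficient : Vec (F p) (suc d) → F p
  coefficient x = (toℕ (lookup x i) * c⁻¹) mod p

  coordinates : Vec (F p) (suc d) → Vec (F p) d × F p
  coordinates x = removeAt (x +ᵥ neg (toℕ (coefficient x)) ·ᵥ u) i , coefficient x

  coefficient-fibre-point : ∀ y t → coefficient (fibre-point y t) ≡ t
  coefficient-fibre-point y t = toℕ-≈-injective (begin
    toℕ (coefficient (fibre-point y t)) % p
      ≡⟨ toℕ-mod _ ⟩
    (toℕ (lookup (fibre-point y t) i) * c⁻¹) % p
      ≡⟨ *-congʳ c⁻¹ (lookup-+ᵥ-·ᵥ (insertAt y i (0F p)) u (toℕ t) i) ⟩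
    ((toℕ (lookup (insertAt y i (0F p)) i) + toℕ t * c) * c⁻¹) % p
      ≡⟨ cong (λ z → ((z + toℕ t * c) * c⁻¹) % p) (trans (cong toℕ (insertAt-lookup y i (0F p))) toℕ-0F) ⟩
    (toℕ t * c * c⁻¹) % p
      ≡⟨ trans (cong (_% p) (*-assoc (toℕ t) c c⁻¹)) (*-congˡ (toℕ t) cc⁻¹≈1) ⟩
    (toℕ t * 1) % p
      ≡⟨ cong (_% p) (*-identityʳ (toℕ t)) ⟩
    toℕ t % p ∎)
    where open ≡-Reasoning

  coordinates-fibre-point : ∀ y t → coordinates (fibre-point y t) ≡ (y , t)
  coordinates-fibre-point y t rewrite coefficient-fibre-point y t = cong (_, t) (begin
    removeAt (fibre-point y t +ᵥ neg (toℕ t) ·ᵥ u) i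
      ≡⟨ cong (λ v → removeAt v i) (+ᵥ-·ᵥ-cancel ι[y] u (toℕ t) (neg (toℕ t)) (neg-inverseʳ (toℕ t))) ⟩
    removeAt ι[y] i
      ≡⟨ removeAt-insertAt y i (0F p) ⟩
    y ∎)
    where
    open ≡-Reasoning
    ι[y] = insertAt y i (0F p)

  fibre-point-coordinates : ∀ x → uncurry fibre-point (coordinates x) ≡ x
  fibre-point-coordinates x = begin
    insertAt (removeAt v i) i (0F p) +ᵥ τ ·ᵥ u       ≡⟨ cong (λ z → insertAt (removeAt v i) i z +ᵥ τ ·ᵥ u) vᵢ≡0 ⟨
    insertAt (removeAt v i) i (lookup v i) +ᵥ τ ·ᵥ u ≡⟨ cong (_+ᵥ τ ·ᵥ u) (insertAt-removeAt v i) ⟩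
    v +ᵥ τ ·ᵥ u                                      ≡⟨ +ᵥ-·ᵥ-cancel x u (neg τ) τ (neg-inverseˡ τ) ⟩
    x                                                ∎
    where
    open ≡-Reasoning
    τ = toℕ (coefficient x)
    v = x +ᵥ neg τ ·ᵥ u
    xᵢ = toℕ (lookup x i)
    τc≈xᵢ : τ * c ≈ xᵢ
    τc≈xᵢ = begin
      (τ * c) % p          ≡⟨ *-congʳ c (toℕ-mod (xᵢ * c⁻¹)) ⟩
      (xᵢ * c⁻¹ * c) % p   ≡⟨ cong (_% p) (trans (*-assoc xᵢ c⁻¹ c) (cong (xᵢ *_) (*-comm c⁻¹ c))) ⟩
      (xᵢ * (c * c⁻¹)) % p ≡⟨ *-congˡ xᵢ cc⁻¹≈1 ⟩
      (xᵢ * 1) % p         ≡⟨ cong (_% p) (*-identityʳ xᵢ) ⟩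
      xᵢ % p               ∎
    vᵢ≡0 : lookup v i ≡ 0F p
    vᵢ≡0 = Equivalence.to (toℕ≈0⇔≡0F (lookup v i)) (+-cancelʳ-≈ xᵢ (begin
      (toℕ (lookup v i) + xᵢ) % p  ≡⟨ +-cong (lookup-+ᵥ-·ᵥ x u (neg τ) i) (sym τc≈xᵢ) ⟩
      (xᵢ + neg τ * c + τ * c) % p ≡⟨ cong (_% p) (solve 4 (λ x m τ c → x :+ m :* τ :* c :+ τ :* c := x :+ (m :* τ :+ τ) :* c)
                                                            refl xᵢ (p ∸ 1) τ c) ⟩
      (xᵢ + (neg τ + τ) * c) % p   ≡⟨ +-congˡ xᵢ (*-congʳ c (neg-inverseˡ τ)) ⟩
      (xᵢ + 0 * c) % p             ≡⟨ cong (_% p) (+-identityʳ xᵢ) ⟩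
      xᵢ % p                       ∎))

  fibration : (Vec (F p) d × F p) ↔ Vec (F p) (suc d)
  fibration = mk↔ₛ′ (uncurry fibre-point) coordinates fibre-point-coordinates (λ (y , t) → coordinates-fibre-point y t)

  ∑-fibres : ∀ (h : Vec (F p) (suc d) → ℕ) →
             ∑ (allVecs p (suc d)) h ≡ ∑[ y ∈ allVecs p d ] ∑[ t ∈ allFin p ] h (fibre-point y t)
  ∑-fibres h = begin
    ∑ (allVecs p (suc d)) h
      ≡⟨ ∑-reindex (≡-dec Fin._≟_) _≟×_ fibration (enumerates-allVecs p (suc d)) pairs-enumerate h ⟨
    ∑ pairs (λ (y , t) → h (fibre-point y t))
      ≡⟨ trans (∑-concatMap _ (allVecs p d) _) (∑-cong (allVecs p d) (λ y → ∑-map (y ,_) (allFin p) _)) ⟩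
    ∑[ y ∈ allVecs p d ] ∑[ t ∈ allFin p ] h (fibre-point y t) ∎
    where
    open ≡-Reasoning
    _≟×_ = ×-≡-dec (≡-dec {n = d} (Fin._≟_ {p})) (Fin._≟_ {p})
    pairs = concatMap (λ y → map (y ,_) (allFin p)) (allVecs p d)
    pairs-enumerate : Enumerates _≟×_ pairs
    pairs-enumerate = enumerates-concatMap (≡-dec Fin._≟_) Fin._≟_ _≟×_ (↔-id _)
                                           (enumerates-allVecs p d) (enumerates-allFin p)

  fibre-point-translate : ∀ y t j → fibre-point y ((toℕ t + j) mod p) ≡ fibre-point y t +ᵥ j ·ᵥ u
  fibre-point-translate y t j = sym (+ᵥ-·ᵥ-merge (insertAt y i (0F p)) u (toℕ t) j (sym (toℕ-mod (toℕ t + j))))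

  fibre-point-0 : ∀ t → fibre-point (0ᵥ d) t ≡ toℕ t ·ᵥ u
  fibre-point-0 t = trans (cong (_+ᵥ toℕ t ·ᵥ u) (insertAt-0ᵥ d i)) (+ᵥ-identityˡ (toℕ t ·ᵥ u))

  -- The functional that vanishes on u and restricts to c b on the complement {x : xᵢ ≡ 0}.
  lift : Vec (F p) d → Vec (F p) (suc d)
  lift b = insertAt (c ·ᵥ b) i (neg (dotℕ b (removeAt u i)) mod p)

  dotℕ-lift-u : ∀ b → dotℕ (lift b) u ≈ 0
  dotℕ-lift-u b = begin
    dotℕ (lift b) u % p                            ≡⟨ cong (λ w → dotℕ (lift b) w % p) (insertAt-removeAt u i) ⟨
    dotℕ (lift b) (insertAt u′ i (lookup u i)) % p ≡⟨ cong (_% p) (dotℕ-insertAt (c ·ᵥ b) u′ i _ (lookup u i)) ⟩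
    (toℕ (neg D mod p) * c + dotℕ (c ·ᵥ b) u′) % p ≡⟨ +-cong (*-congʳ c (toℕ-mod (neg D))) (dotℕ-·ˡ b u′ c) ⟩
    (neg D * c + c * D) % p                        ≡⟨ cong (_% p) (solve 3 (λ m D c → m :* D :* c :+ c :* D := m :* (c :* D) :+ c :* D)
                                                                          refl (p ∸ 1) D c) ⟩
    (neg (c * D) + c * D) % p                      ≡⟨ neg-inverseˡ (c * D) ⟩
    0 % p                                          ∎
    where
    open ≡-Reasoning
    u′ = removeAt u i
    D = dotℕ b u′

  dotℕ-lift : ∀ b y t → dotℕ (lift b) (fibre-point y t) ≈ c * dotℕ b y
  dotℕ-lift b y t = begin
    dotℕ (lift b) (insertAt y i (0F p) +ᵥ toℕ t ·ᵥ u) % p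
      ≡⟨ dotℕ-+ʳ (lift b) _ _ ⟩
    (dotℕ (lift b) (insertAt y i (0F p)) + dotℕ (lift b) (toℕ t ·ᵥ u)) % p
      ≡⟨ +-cong (cong (_% p) (dotℕ-insertAt (c ·ᵥ b) y i _ (0F p))) (dotℕ-·ʳ (lift b) u (toℕ t)) ⟩
    (toℕ α * toℕ (0F p) + dotℕ (c ·ᵥ b) y + toℕ t * dotℕ (lift b) u) % p
      ≡⟨ +-cong (+-cong (cong (λ z → (toℕ α * z) % p) toℕ-0F) (dotℕ-·ˡ b y c))
                (*-congˡ (toℕ t) (dotℕ-lift-u b)) ⟩
    (toℕ α * 0 + c * dotℕ b y + toℕ t * 0) % p
      ≡⟨ cong (_% p) (solve 4 (λ a c D t → a :* con 0 :+ c :* D :+ t :* con 0 := c :* D)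
                              refl (toℕ α) c (dotℕ b y) (toℕ t)) ⟩
    (c * dotℕ b y) % p ∎
    where
    open ≡-Reasoning
    α = neg (dotℕ b (removeAt u i)) mod p

  Hyp-lift : ∀ b y t → Hyp p (lift b) (fibre-point y t) ≡ Hyp p b y
  Hyp-lift b y t = Hyp-cong (lift b) (fibre-point y t) b y (mk⇔ to from)
    where
    to : dotℕ (lift b) (fibre-point y t) ≈ 0 → dotℕ b y ≈ 0
    to lift≈0 with *≈0⇒ p-prime c (dotℕ b y) (trans (sym (dotℕ-lift b y t)) lift≈0)
    ... | inj₁ c≈0 = contradiction c≈0 c≉0
    ... | inj₂ D≈0 = D≈0
    from : dotℕ b y ≈ 0 → dotℕ (lift b) (fibre-point y t) ≈ 0
    from D≈0 = trans (dotℕ-lift b y t) (trans (*-congˡ c D≈0) (cong (_% p) (*-zeroʳ c)))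

  multiple-∈-lift : ∀ b k → _∈_ p (k ·ᵥ u) (Hyp p (lift b))
  multiple-∈-lift b k = Equivalence.from (∈Hyp⇔ (lift b) (k ·ᵥ u))
    (trans (dotℕ-·ʳ (lift b) u k) (trans (*-congˡ k (dotℕ-lift-u b)) (cong (_% p) (*-zeroʳ k))))

  lift-≢0 : ∀ {b} → ¬ b ≡ 0ᵥ d → ¬ lift b ≡ 0ᵥ (suc d)
  lift-≢0 {b} b≢0 lift≡0 = b≢0 (≈-ext λ j → trans (bⱼ≈0 j) (cong (_% p) (sym (toℕ-lookup-0ᵥ j))))
    where
    c·b≡0 : c ·ᵥ b ≡ 0ᵥ d
    c·b≡0 = trans (sym (removeAt-insertAt (c ·ᵥ b) i _)) (trans (cong (λ v → removeAt v i) lift≡0) (removeAt-0ᵥ d i))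
    c·bⱼ≈0 : ∀ j → c * toℕ (lookup b j) ≈ 0
    c·bⱼ≈0 j = trans (sym (lookup-·ᵥ c b j))
                     (trans (cong (λ v → toℕ (lookup v j) % p) c·b≡0) (cong (_% p) (toℕ-lookup-0ᵥ j)))
    bⱼ≈0 : ∀ j → toℕ (lookup b j) ≈ 0
    bⱼ≈0 j with *≈0⇒ p-prime c (toℕ (lookup b j)) (c·bⱼ≈0 j)
    ... | inj₁ c≈0  = contradiction c≈0 c≉0
    ... | inj₂ bⱼ≈0 = bⱼ≈0

  lift-distinct : ∀ {b₁ b₂} → Distinct b₁ b₂ → Distinct (lift b₁) (lift b₂)
  lift-distinct {b₁} {b₂} distinct same = distinct λ y →
    subst₂ (λ u v → u ≡ true ⇔ v ≡ true) (Hyp-lift b₁ y (0F p)) (Hyp-lift b₂ y (0F p)) (same (fibre-point y (0F p)))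

  fibre-mass : Subset p (suc d) → Vec (F p) d → ℕ
  fibre-mass A y = ∑[ t ∈ allFin p ] ⟦ A (fibre-point y t) ⟧

  card-fibres : ∀ A → card p A ≡ mass (fibre-mass A)
  card-fibres A = trans (∑-filter A (allVecs p (suc d))) (∑-fibres (λ x → ⟦ A x ⟧))

  card-lift : ∀ A b → card p (_∩_ p (Hyp p (lift b)) A) ≡ massOn (fibre-mass A) b
  card-lift A b = begin
    card p (_∩_ p (Hyp p (lift b)) A)
      ≡⟨ card-fibres (_∩_ p (Hyp p (lift b)) A) ⟩
    ∑[ y ∈ allVecs p d ] ∑[ t ∈ allFin p ] ⟦ Hyp p (lift b) (fibre-point y t) ∧ A (fibre-point y t) ⟧
      ≡⟨ ∑-cong (allVecs p d) (λ y → ∑-cong (allFin p) (λ t → on-fibre y t)) ⟩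
    ∑[ y ∈ allVecs p d ] ∑[ t ∈ allFin p ] (⟦ Hyp p b y ⟧ * ⟦ A (fibre-point y t) ⟧)
      ≡⟨ ∑-cong (allVecs p d) (λ y → ∑-*ˡ (allFin p) ⟦ Hyp p b y ⟧ _) ⟩
    massOn (fibre-mass A) b ∎
    where
    open ≡-Reasoning
    on-fibre : ∀ y t → ⟦ Hyp p (lift b) (fibre-point y t) ∧ A (fibre-point y t) ⟧ ≡
                       ⟦ Hyp p b y ⟧ * ⟦ A (fibre-point y t) ⟧
    on-fibre y t = trans (⟦∧⟧ (Hyp p (lift b) (fibre-point y t)) (A (fibre-point y t)))
                         (cong (λ h → ⟦ h ⟧ * ⟦ A (fibre-point y t) ⟧) (Hyp-lift b y t))

-- Sum-free sets on lines

module _ (q : ℕ) (B : ℕ → Bool) (B0 : B 0 ≡ true)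
         (avoids : ∀ s k → suc q ≤ k → k < 2 * suc q → B s ≡ true → B (s + k) ≡ false) where

  private
    m = suc q

    m+j<2m : ∀ {j} → j < m → m + j < 2 * m
    m+j<2m {j} j<m = +-monoʳ-< m (subst (j <_) (sym (+-identityʳ m)) j<m)

    at-most-one : ∀ a b → (B a ≡ true → B b ≡ false) → ⟦ B a ⟧ + ⟦ B b ⟧ ≤ 1
    at-most-one a b a⇒¬b with B a
    ... | false = ⟦⟧≤1 (B b)
    ... | true  = ≤-reflexive (cong (λ x → 1 + ⟦ x ⟧) (a⇒¬b refl))

    paired : ∀ j → ⟦ B (suc j) ⟧ + ⟦ B (m + (m + j)) ⟧ ≤ 1
    paired j = at-most-one (suc j) (m + (m + j)) λ B[1+j] →
      subst (λ x → B x ≡ false)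
            (solve 2 (λ j q → (con 1 :+ j) :+ ((con 1 :+ q) :+ q) := (con 1 :+ q) :+ ((con 1 :+ q) :+ j)) refl j q)
            (avoids (suc j) (m + q) (m≤m+n m q) (m+j<2m ≤-refl) B[1+j])

  -- 0 empties the middle third [m, 2m), and the shift 2m - 1 pairs j ∈ [1, m) with j + 2m - 1.
  interval-avoiding-count : ∑[ j < m + (m + q) ] ⟦ B j ⟧ ≤ m
  interval-avoiding-count = begin
    ∑[ j < m + (m + q) ] ⟦ B j ⟧
      ≡⟨ ∑<-+ m (m + q) (λ j → ⟦ B j ⟧) ⟩
    ∑[ j < m ] ⟦ B j ⟧ + ∑[ j < m + q ] ⟦ B (m + j) ⟧
      ≡⟨ cong (∑[ j < m ] ⟦ B j ⟧ +_) (∑<-+ m q (λ j → ⟦ B (m + j) ⟧)) ⟩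
    ∑[ j < m ] ⟦ B j ⟧ + (∑[ j < m ] ⟦ B (m + j) ⟧ + ∑[ j < q ] ⟦ B (m + (m + j)) ⟧)
      ≡⟨ cong (λ z → ∑[ j < m ] ⟦ B j ⟧ + (z + ∑[ j < q ] ⟦ B (m + (m + j)) ⟧)) middle-empty ⟩
    (⟦ B 0 ⟧ + ∑[ j < q ] ⟦ B (suc j) ⟧) + ∑[ j < q ] ⟦ B (m + (m + j)) ⟧
      ≡⟨ trans (+-assoc ⟦ B 0 ⟧ _ _) (cong (⟦ B 0 ⟧ +_) (sym (∑<-distrib-+ q _ _))) ⟩
    ⟦ B 0 ⟧ + ∑[ j < q ] (⟦ B (suc j) ⟧ + ⟦ B (m + (m + j)) ⟧)
      ≤⟨ +-mono-≤ (⟦⟧≤1 (B 0)) (∑<-mono-≤ q paired) ⟩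
    1 + ∑[ j < q ] 1
      ≡⟨ cong suc (trans (∑<-const q 1) (*-identityʳ q)) ⟩
    m ∎
    where
    open ≤-Reasoning
    middle-empty : ∑[ j < m ] ⟦ B (m + j) ⟧ ≡ 0
    middle-empty = trans (∑<-cong m (λ j j<m → cong ⟦_⟧ (avoids 0 (m + j) (m≤m+n m j) (m+j<2m j<m) B0)))
                         (trans (∑<-const m 0) (*-zeroʳ m))

module SumFreeLines (p : ℕ) .{{_ : NonZero p}} (q : ℕ) (p≡3m-1 : p ≡ suc q + (suc q + q))
                    {n} (A : Subset p n) (sum-free : SumFree p A) (u : Vec (F p) n)
                    (I⊆A : ∀ k → suc q ≤ k → k < 2 * suc q → _∈_ p (_·V_ p k u) A) where

  open Vectors p

  line-count : ∀ x → _∈_ p x A → ∑[ j < p ] ⟦ A (x +ᵥ j ·ᵥ u) ⟧ ≤ suc q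
  line-count x x∈A = subst (λ l → ∑[ j < l ] ⟦ A (x +ᵥ j ·ᵥ u) ⟧ ≤ suc q) (sym p≡3m-1)
    (interval-avoiding-count q (λ j → A (x +ᵥ j ·ᵥ u)) (subst (λ v → A v ≡ true) (sym (+ᵥ-0·ᵥ x u)) x∈A) avoids)
    where
    avoids : ∀ s k → suc q ≤ k → k < 2 * suc q → A (x +ᵥ s ·ᵥ u) ≡ true → A (x +ᵥ (s + k) ·ᵥ u) ≡ false
    avoids s k m≤k k<2m xₛ∈A = ¬-not λ xₛ₊ₖ∈A →
      sum-free (x +ᵥ s ·ᵥ u) (k ·ᵥ u) (x +ᵥ (s + k) ·ᵥ u) xₛ∈A (I⊆A k m≤k k<2m) xₛ₊ₖ∈A
               (+ᵥ-·ᵥ-merge x u s k refl)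

  multiples-count : suc q ≤ ∑[ j < p ] ⟦ A (j ·ᵥ u) ⟧
  multiples-count = begin
    m                                                ≡⟨ trans (sym (*-identityʳ m)) (sym (∑<-const m 1)) ⟩
    ∑[ j < m ] 1                                     ≡⟨ ∑<-cong m (λ j j<m → cong ⟦_⟧ (I⊆A (m + j) (m≤m+n m j) (m+j<2m j<m))) ⟨
    ∑[ j < m ] H (m + j)                             ≤⟨ m≤m+n _ (∑[ j < q ] H (m + (m + j))) ⟩
    ∑[ j < m ] H (m + j) + ∑[ j < q ] H (m + (m + j)) ≡⟨ ∑<-+ m q (λ j → H (m + j)) ⟨
    ∑[ j < m + q ] H (m + j)                         ≤⟨ m≤n+m _ (∑[ j < m ] H j) ⟩
    ∑[ j < m ] H j + ∑[ j < m + q ] H (m + j)         ≡⟨ ∑<-+ m (m + q) H ⟨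
    ∑[ j < m + (m + q) ] H j                         ≡⟨ cong (λ l → ∑< l H) p≡3m-1 ⟨
    ∑[ j < p ] H j                                   ∎
    where
    open ≤-Reasoning
    m = suc q
    m+j<2m : ∀ {j} → j < m → m + j < 2 * m
    m+j<2m {j} j<m = +-monoʳ-< m (subst (j <_) (sym (+-identityʳ m)) j<m)
    H : ℕ → ℕ
    H j = ⟦ A (j ·ᵥ u) ⟧

module SumFreeFibres (p : ℕ) .{{_ : NonZero p}} (p-prime : Prime p) (q : ℕ) (p≡3m-1 : p ≡ suc q + (suc q + q))
                     {d} (A : Subset p (suc d)) (sum-free : SumFree p A) (u : Vec (F p) (suc d))
                     (I⊆A : ∀ k → suc q ≤ k → k < 2 * suc q → _∈_ p (_·V_ p k u) A)
                     (i : Fin (suc d)) (uᵢ≢0 : ¬ lookup u i ≡ 0F p) where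

  open Vectors p
  open Translation p
  open Fibration p p-prime u i uᵢ≢0
  open SumFreeLines p q p≡3m-1 A sum-free u I⊆A

  fibre-mass-≤ : ∀ y → fibre-mass A y ≤ suc q
  fibre-mass-≤ y with any? (λ t → A (fibre-point y t) ≟ᵇ true)
  ... | yes (t , x∈A) = ≤-trans (≤-reflexive (begin
    fibre-mass A y
      ≡⟨ ∑-translate (toℕ t) (λ s → ⟦ A (fibre-point y s) ⟧) ⟩
    ∑[ j < p ] ⟦ A (fibre-point y ((toℕ t + j) mod p)) ⟧
      ≡⟨ ∑<-cong p (λ j _ → cong (λ x → ⟦ A x ⟧) (fibre-point-translate y t j)) ⟩
    ∑[ j < p ] ⟦ A (fibre-point y t +ᵥ j ·ᵥ u) ⟧ ∎)) (line-count (fibre-point y t) x∈A)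
    where open ≡-Reasoning
  ... | no none = ≤-trans (≤-reflexive empty) z≤n
    where
    empty : fibre-mass A y ≡ 0
    empty = trans (∑-cong (allFin p) (λ t → cong ⟦_⟧ (¬-not (λ x∈A → none (t , x∈A)))))
                  (trans (∑-allFin-const p 0) (*-zeroʳ p))

  zero-fibre-mass : suc q ≤ fibre-mass A (0ᵥ d)
  zero-fibre-mass = subst (suc q ≤_) (sym (trans (∑-cong (allFin p) (λ t → cong (λ x → ⟦ A x ⟧) (fibre-point-0 t)))
                                                   (∑-allFin-toℕ p (λ j → ⟦ A (j ·ᵥ u) ⟧))))
                          multiples-count

p≡3m-1 : ∀ p → p % 3 ≡ 2 → p ≡ suc (p / 3) + (suc (p / 3) + p / 3)
p≡3m-1 p p%3≡2 = trans (m≡m%n+[m/n]*n p 3) (trans (cong (_+ p / 3 * 3) p%3≡2)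
  (solve 1 (λ q → con 2 :+ q :* con 3 := (con 1 :+ q) :+ ((con 1 :+ q) :+ q)) refl (p / 3)))

[p+1]/3≡m : ∀ p → p % 3 ≡ 2 → (p + 1) / 3 ≡ suc (p / 3)
[p+1]/3≡m p p%3≡2 = trans (cong (_/ 3) p+1≡3m) (m*n/n≡m (suc (p / 3)) 3)
  where
  p+1≡3m : p + 1 ≡ suc (p / 3) * 3
  p+1≡3m = trans (cong (_+ 1) (p≡3m-1 p p%3≡2))
                 (solve 1 (λ q → (con 1 :+ q) :+ ((con 1 :+ q) :+ q) :+ con 1 := (con 1 :+ q) :* con 3) refl (p / 3))

lemma2p3 : (p : ℕ) → .{{_ : NonZero p}} → Prime p → p % 3 ≡ 2 →
    (n : ℕ) → 3 ≤ n → (A : Subset p n) → SumFree p A →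
    (u : Vec (F p) n) → u ≢ 0V p n →
    (∀ k → (p + 1) / 3 ≤ k → k < 2 * ((p + 1) / 3) → _∈_ p (_·V_ p k u) A) →
    Σ (Vec (F p) n) λ a₁ → Σ (Vec (F p) n) λ a₂ →
      a₁ ≢ 0V p n × a₂ ≢ 0V p n ×
      ¬ (∀ x → _∈_ p x (Hyp p a₁) ⇔ _∈_ p x (Hyp p a₂)) ×
      (∀ k → (p + 1) / 3 ≤ k → k < 2 * ((p + 1) / 3) →
        _∈_ p (_·V_ p k u) (_∩_ p (Hyp p a₁) (Hyp p a₂))) ×
      card p A ≤ p * card p (_∩_ p (Hyp p a₁) A) ×
      card p A ≤ p * card p (_∩_ p (Hyp p a₂) A)
lemma2p3 p p-prime p%3≡2 (suc (suc (suc e))) (s≤s (s≤s (s≤s z≤n))) A sum-free u u≢0 I⊆A =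
  lift b₁ , lift b₂ , lift-≢0 b₁≢0 , lift-≢0 b₂≢0 , lift-distinct distinct ,
  (λ k _ _ → cong₂ _∧_ (multiple-∈-lift b₁ k) (multiple-∈-lift b₂ k)) ,
  card-bound good₁ , card-bound good₂
  where
  m≡ = [p+1]/3≡m p p%3≡2
  I⊆A′ : ∀ k → suc (p / 3) ≤ k → k < 2 * suc (p / 3) → _∈_ p (_·V_ p k u) A
  I⊆A′ k m≤k k<2m = I⊆A k (subst (_≤ k) (sym m≡) m≤k) (subst (λ m → k < 2 * m) (sym m≡) k<2m)
  i = proj₁ (Vectors.nonzero-coordinate p u≢0)
  uᵢ≢0 = proj₂ (Vectors.nonzero-coordinate p u≢0)
  open HyperplaneMass p p-prime
  open Fibration p p-prime u i uᵢ≢0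
  open SumFreeFibres p p-prime (p / 3) (p≡3m-1 p p%3≡2) A sum-free u I⊆A′ i uᵢ≢0
  open TwoGoodHyperplanes (two-good-hyperplanes e (fibre-mass A) fibre-mass-≤ zero-fibre-mass)
  card-bound : ∀ {b} → Good (fibre-mass A) b → card p A ≤ p * card p (_∩_ p (Hyp p (lift b)) A)
  card-bound {b} = subst₂ (λ x y → x ≤ p * y) (sym (card-fibres A)) (sym (card-lift A b))
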